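{- For each integer $n\ge 2$, the number of isomorphism classes of simple games with $n$ players that have exactly two equivalence classes of players is $$2^{n+1}-\frac{n^2+3n+4}{2}\quad\text{if } n \text{ is odd},\qquad 2^{n+1}+2^{n/2}-\frac{n^2+4n+6}{2}\quad\text{if } n \text{ is even}.$$
   Context: A simple game with player set $N=\{1,\dots,n\}$ is a map $v\colon 2^N\to\{0,1\}$ with $v(\emptyset)=0$, $v(N)=1$, and $v(S)\le v(T)$ whenever $S\subseteq T\subseteq N$. Two players $i,j\in N$ are equivalent if $v(S\cup\{i\})=v(S\cup\{j\})$ for all $S\subseteq N\setminus\{i,j\}$; this is an equivalence relation on $N$, and its classes are the equivalence classes of players of $v$. Two simple games $v,v'$ on $N$ are isomorphic if there is a permutation $\sigma$ of $N$ with $v'(\sigma(S))=v(S)$ for all $S\subseteq N$ (i.e., they differ only by a relabeling of the players). -}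

module Defs where

open import Data.Nat using (ℕ; _+_; _*_; _∸_; _^_; _/_; _%_)
open import Data.Bool using (Bool; true; false) renaming (_≤_ to _≤ᵇ_)
open import Data.Fin using (Fin)
open import Data.Fin.Subset using (Subset; ⊥; ⊤; _⊆_; _∪_; ⁅_⁆; _∉_; inside; outside)
open import Data.Fin.Permutation using (Permutation′; _⟨$⟩ˡ_)
open import Data.Vec using (tabulate; lookup)
open import Data.Product using (Σ; _×_; ∃₂)
open import Data.Sum using (_⊎_)
open import Relation.Nullary using (¬_)
open import Relation.Binary.PropositionalEquality using (_≡_)

-- A (candidate) game on the player set Fin n: a map v : 2^N → {0,1},
-- with 0 = false, 1 = true; coalitions are subsets of Fin n.
Game : ℕ → Set
Game n = Subset n → Bool

record IsSimpleGame {n : ℕ} (v : Game n) : Set where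
  field
    empty-lose : v ⊥ ≡ false
    grand-win  : v ⊤ ≡ true
    monotone   : ∀ (S T : Subset n) → S ⊆ T → v S ≤ᵇ v T

Equivalent : {n : ℕ} → Game n → Fin n → Fin n → Set
Equivalent {n} v i j =
  ∀ (S : Subset n) → i ∉ S → j ∉ S → v (S ∪ ⁅ i ⁆) ≡ v (S ∪ ⁅ j ⁆)

-- v has exactly two equivalence classes of players: there are two
-- non-equivalent players i, j, and every player is equivalent to i or to j
-- (so the classes are exactly [i] ≠ [j]).
HasExactlyTwoClasses : {n : ℕ} → Game n → Set
HasExactlyTwoClasses {n} v =
  ∃₂ λ (i j : Fin n) → ¬ Equivalent v i j × (∀ k → Equivalent v k i ⊎ Equivalent v k j)

-- Image σ(S) of a coalition under a permutation σ of the players: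
-- j ∈ σ(S) iff σ⁻¹(j) ∈ S.
image : {n : ℕ} → Permutation′ n → Subset n → Subset n
image σ S = tabulate λ j → lookup S (σ ⟨$⟩ˡ j)

Isomorphic : {n : ℕ} → Game n → Game n → Set
Isomorphic {n} v v' = Σ (Permutation′ n) λ σ → ∀ (S : Subset n) → v' (image σ S) ≡ v S

countOdd : ℕ → ℕ
countOdd n = 2 ^ (n + 1) ∸ (n * n + 3 * n + 4) / 2

countEven : ℕ → ℕ
countEven n = 2 ^ (n + 1) + 2 ^ (n / 2) ∸ (n * n + 4 * n + 6) / 2

{-# OPTIONS --safe #-}
module Submission where

-- Let the two classes be Q and ¬ Q.  As the players of a class are
-- interchangeable, a game is determined by a monotone Boolean function of the
-- number of members in Q and the number of non-members in ¬ Q, i.e. by a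
-- lattice path through the (|Q| + 1) × (|¬ Q| + 1) grid: a word of length
-- m = n + 2 with |Q| + 1 right and |¬ Q| + 1 down steps.  The classes are
-- distinct iff the path is not invariant under the diagonal shift
-- (x , d) ↦ (x + 1 , d + 1); the invariant words are the 2 constant ones and the
-- (m − 1) m threshold paths.  Relabelling the players can only swap the two
-- classes, which reverses and complements the word, so the isomorphism classes
-- are the orbits of this involution on the non-invariant words.  Its fixed
-- points are the words u ++ dual u: none for m odd, 2^(m/2) for m even, m of
-- them invariant.  Hence 2 · #classes is 2^m − 2 − (m − 1) m for m odd and
-- 2^m + 2^(m/2) − 2 − (m − 1) m − m for m even.

open import Data.Nat using (ℕ; zero; suc; _+_; _*_; _∸_; _^_; _/_; _%_; _≤_; _<_; _>_; z≤n; s≤s; _<ᵇ_; pred; _⊓_; >-nonZero; _≤′_; ≤′-refl; ≤′-step; _<?_; _≤?_)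
open import Data.Nat.Properties
open import Data.Nat.DivMod using (m≡m%n+[m/n]*n; m*n/n≡m)
open import Data.Nat.Tactic.RingSolver using (solve-∀)
open import Data.Bool using (Bool; true; false; not; _∧_; _∨_; T?; b≤b; f≤t) renaming (_≤_ to _≤ᴮ_)
open import Data.Bool.Properties using (not-involutive; ∧-zeroʳ; ∧-identityʳ; ∨-identityʳ; ∨-zeroʳ; T-≡)
import Data.Bool.Properties as Bool
open import Data.Product using (Σ; _×_; _,_; proj₁; proj₂)
open import Data.Sum using (_⊎_; inj₁; inj₂)
open import Data.Empty using (⊥; ⊥-elim)
open import Data.List using (List; []; _∷_; _++_; map; reverse; length; replicate; [_]; filterᵇ; upTo; cartesianProduct; take; drop)
open import Data.List.Properties using (unfold-reverse; reverse-++; reverse-involutive; length-reverse; reverse-map; map-++; length-map; length-++; length-upTo; length-replicate; take++drop≡id; length-take; length-drop; ≡-dec; ∷-injective; ∷-injectiveʳ)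
open import Data.List.Membership.Propositional using (_∈_)
open import Data.List.Membership.Propositional.Properties using (∈-map⁺; ∈-map⁻; ∈-++⁺ˡ; ∈-++⁺ʳ; ∈-++⁻; ∈-upTo⁺; ∈-upTo⁻; ∈-cartesianProduct⁺; ∈-cartesianProduct⁻; ∈-filter⁺; ∈-filter⁻)
open import Data.List.Membership.Propositional.Properties.WithK using (unique∧set⇒bag)
open import Data.List.Relation.Binary.BagAndSetEquality using (∼bag⇒↭)
open import Data.List.Relation.Binary.Permutation.Propositional using (_↭_; prep; swap) renaming (refl to ↭-refl; trans to ↭-trans)
open import Data.List.Relation.Binary.Permutation.Propositional.Properties using (↭-length)
open import Data.List.Relation.Unary.All using (All; []; _∷_)
import Data.List.Relation.Unary.All as All
import Data.List.Relation.Unary.All.Properties as All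
open import Data.List.Relation.Unary.Any using (Any; here; there)
import Data.List.Relation.Unary.Any as Any
import Data.List.Relation.Unary.Any.Properties as Any
open import Data.List.Relation.Unary.AllPairs using (AllPairs; []; _∷_)
open import Data.List.Relation.Unary.Unique.Propositional using (Unique)
import Data.List.Relation.Unary.Unique.Propositional.Properties as Unique
open import Data.Fin using (Fin; zero; suc; toℕ; fromℕ<; punchIn)
open import Data.Fin.Properties using (toℕ-fromℕ<)
import Data.Fin.Properties as Fin
open import Data.Fin.Subset using (Subset; _⊆_; _∪_; ⁅_⁆; _∉_)
open import Data.Fin.Permutation using (Permutation′; _⟨$⟩ʳ_; _⟨$⟩ˡ_; inverseˡ; lift₀; insert; id)
open import Data.Vec using (tabulate; lookup)
open import Data.Vec.Properties using (lookup∘tabulate; tabulate∘lookup; tabulate-cong; lookup-zipWith; lookup-replicate; []=⇒lookup; lookup⇒[]=)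
open import Algebra.Properties.CommutativeMonoid.Sum +-0-commutativeMonoid using (sum; sum-permute)
open import Function using (_∘_)
open import Function.Bundles using (mk⇔; Equivalence)
open import Relation.Nullary using (¬_; yes; no; does)
open import Relation.Binary using (Tri; tri<; tri≈; tri>)
open import Relation.Binary.PropositionalEquality hiding ([_])
open import Defs

true≢false : true ≢ false
true≢false ()

∧-true₁ : ∀ {a b} → a ∧ b ≡ true → a ≡ true
∧-true₁ {true} _ = refl

∧-true₂ : ∀ {a b} → a ∧ b ≡ true → b ≡ true
∧-true₂ {true} e = e

<ᵇ-true : ∀ {m n} → m < n → (m <ᵇ n) ≡ true
<ᵇ-true {zero}  {suc n} _       = refl
<ᵇ-true {suc m} {suc n} (s≤s p) = <ᵇ-true p

<ᵇ-false : ∀ {m n} → n ≤ m → (m <ᵇ n) ≡ false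
<ᵇ-false {m}     {zero}  _       = refl
<ᵇ-false {suc m} {suc n} (s≤s p) = <ᵇ-false p

<ᵇ-true⁻ : ∀ {m n} → (m <ᵇ n) ≡ true → m < n
<ᵇ-true⁻ {zero}  {suc n} _ = s≤s z≤n
<ᵇ-true⁻ {suc m} {suc n} e = s≤s (<ᵇ-true⁻ e)

<ᵇ-false⁻ : ∀ {m n} → (m <ᵇ n) ≡ false → n ≤ m
<ᵇ-false⁻ {m}     {zero}  _ = z≤n
<ᵇ-false⁻ {suc m} {suc n} e = s≤s (<ᵇ-false⁻ e)

<ᵇ-cong : ∀ {a b c d} → (a < b → c < d) → (c < d → a < b) → (a <ᵇ b) ≡ (c <ᵇ d)
<ᵇ-cong {a} {b} {c} {d} f g with a <ᵇ b in e₁ | c <ᵇ d in e₂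
... | true  | true  = refl
... | false | false = refl
... | true  | false = ⊥-elim (<⇒≱ (f (<ᵇ-true⁻ e₁)) (<ᵇ-false⁻ e₂))
... | false | true  = ⊥-elim (<⇒≱ (g (<ᵇ-true⁻ e₂)) (<ᵇ-false⁻ e₁))

<ᵇ-shift : ∀ a b c d x y → a + x ≡ c + y → b + x ≡ d + y → (a <ᵇ b) ≡ (c <ᵇ d)
<ᵇ-shift a b c d x y p q = <ᵇ-cong
  (λ h → +-cancelʳ-< y c d (subst₂ _<_ p q (+-monoˡ-< x h)))
  (λ h → +-cancelʳ-< x a b (subst₂ _<_ (sym p) (sym q) (+-monoˡ-< y h)))

_==_ : Bool → Bool → Bool
true  == b = b
false == b = not b

==⇒≡ : ∀ a b → (a == b) ≡ true → a ≡ b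
==⇒≡ true  true  _ = refl
==⇒≡ false false _ = refl

==-true : ∀ a → (a == true) ≡ a
==-true true  = refl
==-true false = refl

==-false : ∀ a → (a == false) ≡ not a
==-false true  = refl
==-false false = refl

==-refl : ∀ a → (a == a) ≡ true
==-refl true  = refl
==-refl false = refl

all< : ℕ → (ℕ → Bool) → Bool
all< zero    p = true
all< (suc N) p = all< N p ∧ p N

all<-sound : ∀ N p → all< N p ≡ true → ∀ i → i < N → p i ≡ true
all<-sound (suc N) p e i i<N with m<1+n⇒m<n∨m≡n i<N
... | inj₁ lt   = all<-sound N p (∧-true₁ e) i lt
... | inj₂ refl = ∧-true₂ {all< N p} e

all<-complete : ∀ N p → (∀ i → i < N → p i ≡ true) → all< N p ≡ true
all<-complete zero    p h = refl
all<-complete (suc N) p h rewrite all<-complete N p (λ i lt → h i (m<n⇒m<1+n lt)) = h N ≤-refl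

upClosed-≤ : ∀ (g : ℕ → Bool) → (∀ p → g p ≡ true → g (suc p) ≡ true) → ∀ {a b} → a ≤ b → g a ≡ true → g b ≡ true
upClosed-≤ g up a≤b = go (≤⇒≤′ a≤b)
  where
  go : ∀ {a b} → a ≤′ b → g a ≡ true → g b ≡ true
  go ≤′-refl     h = h
  go (≤′-step p) h = up _ (go p h)

upClosed⇒threshold : ∀ N (g : ℕ → Bool) → (∀ p → g p ≡ true → g (suc p) ≡ true) →
                     Σ ℕ λ k → k ≤ N × (∀ p → p < N → g p ≡ (k <ᵇ suc p))
upClosed⇒threshold zero    g up = 0 , z≤n , λ _ ()
upClosed⇒threshold (suc M) g up with upClosed⇒threshold M g up
... | k , k≤M , below with m≤n⇒m<n∨m≡n k≤M
...   | inj₁ k<M = k , m≤n⇒m≤1+n k≤M , extend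
  where
  extend : ∀ p → p < suc M → g p ≡ (k <ᵇ suc p)
  extend p p<1+M with m<1+n⇒m<n∨m≡n p<1+M
  ... | inj₁ p<M  = below p p<M
  ... | inj₂ refl = trans (upClosed-≤ g up k≤M (trans (below k k<M) (<ᵇ-true {k} ≤-refl))) (sym (<ᵇ-true (s≤s k≤M)))
...   | inj₂ refl with g k in gk
...     | true  = k , n≤1+n k , extend
  where
  extend : ∀ p → p < suc k → g p ≡ (k <ᵇ suc p)
  extend p p<1+k with m<1+n⇒m<n∨m≡n p<1+k
  ... | inj₁ p<k  = below p p<k
  ... | inj₂ refl = trans gk (sym (<ᵇ-true {p} ≤-refl))
...     | false = suc k , ≤-refl , extend
  where
  extend : ∀ p → p < suc k → g p ≡ (suc k <ᵇ suc p)
  extend p p<1+k with m<1+n⇒m<n∨m≡n p<1+k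
  ... | inj₁ p<k  = trans (below p p<k) (trans (<ᵇ-false p<k) (sym (<ᵇ-false (m<n⇒m<1+n p<k))))
  ... | inj₂ refl = trans gk (sym (<ᵇ-false {p} {p} ≤-refl))

odd≢even : ∀ j a → suc (j + j) ≢ a + a
odd≢even j       zero    ()
odd≢even zero    (suc a) e with trans (suc-injective e) (+-suc a a)
... | ()
odd≢even (suc j) (suc a) e =
  odd≢even j a (suc-injective (trans (trans (sym (cong suc (+-suc j j))) (suc-injective e)) (+-suc a a)))

+-self-injective : ∀ a b → a + a ≡ b + b → a ≡ b
+-self-injective zero    zero    _ = refl
+-self-injective (suc a) (suc b) e =
  cong suc (+-self-injective a b (suc-injective (trans (trans (sym (+-suc a a)) (suc-injective e)) (+-suc b b))))

m+m+n*2≡o*2⇒m≡o∸n : ∀ C H X → C + C + H * 2 ≡ X * 2 → C ≡ X ∸ H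
m+m+n*2≡o*2⇒m≡o∸n C H X e = trans (sym (m+n∸n≡m C H)) (cong (_∸ H) (*-cancelʳ-≡ (C + H) X 2 (trans (double C H) e)))
  where
  double : ∀ C H → (C + H) * 2 ≡ C + C + H * 2
  double = solve-∀

2^[n+2] : ∀ n → 2 ^ (n + 2) ≡ 2 ^ (n + 1) * 2
2^[n+2] n = trans (cong (2 ^_) (+-suc n 1)) (*-comm 2 (2 ^ (n + 1)))

bit : Bool → ℕ
bit true  = 1
bit false = 0

module _ {A : Set} where

  countᵇ : (A → Bool) → List A → ℕ
  countᵇ p []       = 0
  countᵇ p (x ∷ xs) = bit (p x) + countᵇ p xs

  length-filterᵇ : ∀ (p : A → Bool) xs → length (filterᵇ p xs) ≡ countᵇ p xs
  length-filterᵇ p []       = refl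
  length-filterᵇ p (x ∷ xs) with p x
  ... | true  = cong suc (length-filterᵇ p xs)
  ... | false = length-filterᵇ p xs

  ∈-filterᵇ⁺ : ∀ (p : A → Bool) {x xs} → x ∈ xs → p x ≡ true → x ∈ filterᵇ p xs
  ∈-filterᵇ⁺ p x∈ px = ∈-filter⁺ (T? ∘ p) x∈ (Equivalence.from T-≡ px)

  ∈-filterᵇ⁻ : ∀ (p : A → Bool) {x xs} → x ∈ filterᵇ p xs → x ∈ xs × p x ≡ true
  ∈-filterᵇ⁻ p x∈ with ∈-filter⁻ (T? ∘ p) x∈
  ... | x∈xs , px = x∈xs , Equivalence.to T-≡ px

  Unique-filterᵇ : ∀ (p : A → Bool) {xs} → Unique xs → Unique (filterᵇ p xs)
  Unique-filterᵇ p = Unique.filter⁺ (T? ∘ p)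

  countᵇ-filterᵇ : ∀ (p q : A → Bool) xs → countᵇ q (filterᵇ p xs) ≡ countᵇ (λ x → p x ∧ q x) xs
  countᵇ-filterᵇ p q []       = refl
  countᵇ-filterᵇ p q (x ∷ xs) with p x
  ... | true  = cong (bit (q x) +_) (countᵇ-filterᵇ p q xs)
  ... | false = countᵇ-filterᵇ p q xs

  countᵇ-complement : ∀ (p : A → Bool) xs → countᵇ p xs + countᵇ (not ∘ p) xs ≡ length xs
  countᵇ-complement p []       = refl
  countᵇ-complement p (x ∷ xs) with p x
  ... | true  = cong suc (countᵇ-complement p xs)
  ... | false = trans (+-suc (countᵇ p xs) _) (cong suc (countᵇ-complement p xs))

  countᵇ-split : ∀ (p q : A → Bool) xs → countᵇ q xs ≡ countᵇ (λ x → p x ∧ q x) xs + countᵇ (λ x → not (p x) ∧ q x) xs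
  countᵇ-split p q []       = refl
  countᵇ-split p q (x ∷ xs) = trans (cong (bit (q x) +_) (countᵇ-split p q xs)) (split (p x) (q x) _ _)
    where
    split : ∀ a b m k → bit b + (m + k) ≡ (bit (a ∧ b) + m) + (bit (not a ∧ b) + k)
    split true  true  m k = refl
    split true  false m k = refl
    split false true  m k = sym (+-suc m k)
    split false false m k = refl

  countᵇ-none : ∀ (p : A → Bool) xs → (∀ x → x ∈ xs → p x ≡ false) → countᵇ p xs ≡ 0
  countᵇ-none p []       h = refl
  countᵇ-none p (x ∷ xs) h rewrite h x (here refl) = countᵇ-none p xs (λ y m → h y (there m))

  countᵇ-pointwise : ∀ (p q r : A → Bool) xs → (∀ x → bit (p x) + bit (q x) ≡ 1 + bit (r x)) →
                     countᵇ p xs + countᵇ q xs ≡ length xs + countᵇ r xs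
  countᵇ-pointwise p q r []       h = refl
  countᵇ-pointwise p q r (x ∷ xs) h = begin
    (bit (p x) + countᵇ p xs) + (bit (q x) + countᵇ q xs) ≡⟨ interchange (bit (p x)) _ (bit (q x)) _ ⟩
    (bit (p x) + bit (q x)) + (countᵇ p xs + countᵇ q xs) ≡⟨ cong₂ _+_ (h x) (countᵇ-pointwise p q r xs h) ⟩
    (1 + bit (r x)) + (length xs + countᵇ r xs)           ≡⟨ interchange 1 (bit (r x)) (length xs) _ ⟩
    suc (length xs) + (bit (r x) + countᵇ r xs)           ∎
    where
    open ≡-Reasoning
    interchange : ∀ a b c d → (a + b) + (c + d) ≡ (a + c) + (b + d)
    interchange = solve-∀

  countᵇ-↭ : ∀ (p : A → Bool) {xs ys} → xs ↭ ys → countᵇ p xs ≡ countᵇ p ys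
  countᵇ-↭ p ↭-refl          = refl
  countᵇ-↭ p (prep x q)      = cong (bit (p x) +_) (countᵇ-↭ p q)
  countᵇ-↭ p (swap x y q)    =
    trans (+-assoc-comm (bit (p x)) (bit (p y)) _) (cong (λ z → bit (p y) + (bit (p x) + z)) (countᵇ-↭ p q))
    where
    +-assoc-comm : ∀ a b c → a + (b + c) ≡ b + (a + c)
    +-assoc-comm = solve-∀
  countᵇ-↭ p (↭-trans q q′) = trans (countᵇ-↭ p q) (countᵇ-↭ p q′)

  sameMembers⇒↭ : ∀ {xs ys : List A} → Unique xs → Unique ys →
                  (∀ {z} → z ∈ xs → z ∈ ys) → (∀ {z} → z ∈ ys → z ∈ xs) → xs ↭ ys
  sameMembers⇒↭ ux uy f g = ∼bag⇒↭ (unique∧set⇒bag ux uy (mk⇔ f g))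

  sameMembers⇒length≡ : ∀ {xs ys : List A} → Unique xs → Unique ys →
                        (∀ {z} → z ∈ xs → z ∈ ys) → (∀ {z} → z ∈ ys → z ∈ xs) → length xs ≡ length ys
  sameMembers⇒length≡ ux uy f g = ↭-length (sameMembers⇒↭ ux uy f g)

module _ {A B : Set} where

  countᵇ-map : ∀ (p : B → Bool) (f : A → B) xs → countᵇ p (map f xs) ≡ countᵇ (p ∘ f) xs
  countᵇ-map p f []       = refl
  countᵇ-map p f (x ∷ xs) = cong (bit (p (f x)) +_) (countᵇ-map p f xs)

  Unique-map-injectiveOn : ∀ (f : A → B) xs → (∀ {x y} → x ∈ xs → y ∈ xs → f x ≡ f y → x ≡ y) →
                           Unique xs → Unique (map f xs)
  Unique-map-injectiveOn f []       inj []       = []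
  Unique-map-injectiveOn f (x ∷ xs) inj (x∉ ∷ u) =
    distinctImages xs x∉ (λ m → m) ∷ Unique-map-injectiveOn f xs (λ mx my → inj (there mx) (there my)) u
    where
    distinctImages : ∀ ys → All (x ≢_) ys → (∀ {y} → y ∈ ys → y ∈ xs) → All (f x ≢_) (map f ys)
    distinctImages []       []         _   = []
    distinctImages (y ∷ ys) (x≢y ∷ ne) sub =
      (λ e → x≢y (inj (here refl) (there (sub (here refl))) e)) ∷ distinctImages ys ne (sub ∘ there)

  length-cartesianProduct : ∀ (xs : List A) (ys : List B) → length (cartesianProduct xs ys) ≡ length xs * length ys
  length-cartesianProduct []       ys = refl
  length-cartesianProduct (x ∷ xs) ys =
    trans (length-++ (map (x ,_) ys)) (cong₂ _+_ (length-map (x ,_) ys) (length-cartesianProduct xs ys))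

-- Orbit counting for an involution f: c meets every orbit {x , f x} once,
-- or twice where fx holds.
countᵇ-involution : ∀ {A : Set} (f : A → A) (c fx : A → Bool) xs → (∀ x → f (f x) ≡ x) → Unique xs →
                    (∀ {x} → x ∈ xs → f x ∈ xs) → (∀ x → bit (c x) + bit (c (f x)) ≡ 1 + bit (fx x)) →
                    countᵇ c xs + countᵇ c xs ≡ length xs + countᵇ fx xs
countᵇ-involution f c fx xs inv u closed pw = begin
  countᵇ c xs + countᵇ c xs         ≡⟨ cong (countᵇ c xs +_) (countᵇ-↭ c (sameMembers⇒↭ u u-map into onto)) ⟩
  countᵇ c xs + countᵇ c (map f xs) ≡⟨ cong (countᵇ c xs +_) (countᵇ-map c f xs) ⟩
  countᵇ c xs + countᵇ (c ∘ f) xs   ≡⟨ countᵇ-pointwise c (c ∘ f) fx xs pw ⟩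
  length xs + countᵇ fx xs          ∎
  where
  open ≡-Reasoning
  u-map : Unique (map f xs)
  u-map = Unique-map-injectiveOn f xs (λ {x} {y} _ _ e → trans (sym (inv x)) (trans (cong f e) (inv y))) u
  into : ∀ {z} → z ∈ xs → z ∈ map f xs
  into {z} m = subst (_∈ map f xs) (inv z) (∈-map⁺ f (closed m))
  onto : ∀ {z} → z ∈ map f xs → z ∈ xs
  onto m with ∈-map⁻ f m
  ... | y , my , refl = closed my

++-injective : ∀ {A : Set} (u u′ v v′ : List A) → length u ≡ length u′ → u ++ v ≡ u′ ++ v′ → u ≡ u′ × v ≡ v′
++-injective []      []        v v′ _ e = refl , e
++-injective (c ∷ u) (c′ ∷ u′) v v′ l e with ∷-injective e
... | refl , e′ with ++-injective u u′ v v′ (suc-injective l) e′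
...   | refl , v≡v′ = refl , v≡v′

countᶠ : ∀ {n} → (Fin n → Bool) → ℕ
countᶠ {zero}  f = 0
countᶠ {suc n} f = bit (f zero) + countᶠ (f ∘ suc)

countᶠ≡sum : ∀ {n} (f : Fin n → Bool) → countᶠ f ≡ sum (bit ∘ f)
countᶠ≡sum {zero}  f = refl
countᶠ≡sum {suc n} f = cong (bit (f zero) +_) (countᶠ≡sum (f ∘ suc))

countᶠ-permute : ∀ {n} (σ : Permutation′ n) (f : Fin n → Bool) → countᶠ (f ∘ (σ ⟨$⟩ʳ_)) ≡ countᶠ f
countᶠ-permute σ f = trans (countᶠ≡sum (f ∘ (σ ⟨$⟩ʳ_))) (trans (sym (sum-permute (bit ∘ f) σ)) (sym (countᶠ≡sum f)))

countᶠ-cong : ∀ {n} {f g : Fin n → Bool} → (∀ i → f i ≡ g i) → countᶠ f ≡ countᶠ g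
countᶠ-cong {zero}  h = refl
countᶠ-cong {suc n} h = cong₂ _+_ (cong bit (h zero)) (countᶠ-cong (h ∘ suc))

bit-mono : ∀ {a b} → (a ≡ true → b ≡ true) → bit a ≤ bit b
bit-mono {false} _ = z≤n
bit-mono {true}  h rewrite h refl = ≤-refl

countᶠ-mono : ∀ {n} (f g : Fin n → Bool) → (∀ i → f i ≡ true → g i ≡ true) → countᶠ f ≤ countᶠ g
countᶠ-mono {zero}  f g h = z≤n
countᶠ-mono {suc n} f g h = +-mono-≤ (bit-mono (h zero)) (countᶠ-mono _ _ (h ∘ suc))

countᶠ-mono-< : ∀ {n} (f g : Fin n → Bool) k → (∀ i → f i ≡ true → g i ≡ true) →
                f k ≡ false → g k ≡ true → countᶠ f < countᶠ g
countᶠ-mono-< f g zero    h fk gk rewrite fk | gk = s≤s (countᶠ-mono _ _ (h ∘ suc))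
countᶠ-mono-< f g (suc k) h fk gk = +-mono-≤-< (bit-mono (h zero)) (countᶠ-mono-< _ _ k (h ∘ suc) fk gk)

countᶠ-split : ∀ {n} (h g : Fin n → Bool) → countᶠ g ≡ countᶠ (λ i → h i ∧ g i) + countᶠ (λ i → not (h i) ∧ g i)
countᶠ-split {zero}  h g = refl
countᶠ-split {suc n} h g =
  trans (cong (bit (g zero) +_) (countᶠ-split (h ∘ suc) (g ∘ suc))) (split (h zero) (g zero) _ _)
  where
  split : ∀ a b m k → bit b + (m + k) ≡ (bit (a ∧ b) + m) + (bit (not a ∧ b) + k)
  split true  true  m k = refl
  split true  false m k = refl
  split false true  m k = sym (+-suc m k)
  split false false m k = refl

countᶠ-false : ∀ {n} → countᶠ {n} (λ _ → false) ≡ 0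
countᶠ-false {zero}  = refl
countᶠ-false {suc n} = countᶠ-false {n}

countᶠ-complement : ∀ {n} (f : Fin n → Bool) → countᶠ f + countᶠ (not ∘ f) ≡ n
countᶠ-complement {zero}  f = refl
countᶠ-complement {suc n} f with f zero
... | true  = cong suc (countᶠ-complement (f ∘ suc))
... | false = trans (+-suc (countᶠ (f ∘ suc)) _) (cong suc (countᶠ-complement (f ∘ suc)))

countᶠ≤ : ∀ {n} (f : Fin n → Bool) → countᶠ f ≤ n
countᶠ≤ f = subst (countᶠ f ≤_) (countᶠ-complement f) (m≤m+n _ _)

countᶠ>0⇒witness : ∀ {n} (f : Fin n → Bool) → 0 < countᶠ f → Σ (Fin n) λ i → f i ≡ true
countᶠ>0⇒witness {suc n} f p with f zero in e
... | true  = zero , e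
... | false with countᶠ>0⇒witness (f ∘ suc) p
...   | i , q = suc i , q

_==ᶠ_ : ∀ {n} → Fin n → Fin n → Bool
zero  ==ᶠ zero  = true
zero  ==ᶠ suc j = false
suc i ==ᶠ zero  = false
suc i ==ᶠ suc j = i ==ᶠ j

==ᶠ-refl : ∀ {n} (i : Fin n) → (i ==ᶠ i) ≡ true
==ᶠ-refl zero    = refl
==ᶠ-refl (suc i) = ==ᶠ-refl i

==ᶠ⇒≡ : ∀ {n} (i j : Fin n) → (i ==ᶠ j) ≡ true → i ≡ j
==ᶠ⇒≡ zero    zero    _ = refl
==ᶠ⇒≡ (suc i) (suc j) e = cong suc (==ᶠ⇒≡ i j e)

≢⇒==ᶠ-false : ∀ {n} (i j : Fin n) → i ≢ j → (i ==ᶠ j) ≡ false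
≢⇒==ᶠ-false i j ne with i ==ᶠ j in e
... | false = refl
... | true  = ⊥-elim (ne (==ᶠ⇒≡ i j e))

countᶠ-singleton : ∀ {n} (k : Fin n) → countᶠ (k ==ᶠ_) ≡ 1
countᶠ-singleton {suc n} zero    = cong suc (countᶠ-false {n})
countᶠ-singleton {suc n} (suc k) = countᶠ-singleton k

countᶠ≡0⇒false : ∀ {n} (f : Fin n → Bool) → countᶠ f ≡ 0 → ∀ i → f i ≡ false
countᶠ≡0⇒false f e i with f i in fi
... | false = refl
... | true  = ⊥-elim (<-irrefl (sym e) (subst (_≤ countᶠ f) (countᶠ-singleton i) (countᶠ-mono (i ==ᶠ_) f atI)))
  where
  atI : ∀ j → (i ==ᶠ j) ≡ true → f j ≡ true
  atI j e′ = subst (λ z → f z ≡ true) (==ᶠ⇒≡ i j e′) fi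

countᶠ-update : ∀ {n} (f g : Fin n → Bool) k → (∀ i → i ≢ k → f i ≡ g i) → countᶠ f + bit (g k) ≡ countᶠ g + bit (f k)
countᶠ-update {suc n} f g zero h =
  trans (cong (λ z → bit (f zero) + z + bit (g zero)) (countᶠ-cong (λ i → h (suc i) (λ ())))) (swap₁₃ (bit (f zero)) _ (bit (g zero)))
  where
  swap₁₃ : ∀ a c b → a + c + b ≡ b + c + a
  swap₁₃ = solve-∀
countᶠ-update {suc n} f g (suc k) h = begin
  bit (f zero) + countᶠ (f ∘ suc) + bit (g (suc k))   ≡⟨ +-assoc (bit (f zero)) _ _ ⟩
  bit (f zero) + (countᶠ (f ∘ suc) + bit (g (suc k))) ≡⟨ cong₂ _+_ (cong bit (h zero (λ ())))
                                                         (countᶠ-update (f ∘ suc) (g ∘ suc) k (λ i ne → h (suc i) (ne ∘ Fin.suc-injective))) ⟩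
  bit (g zero) + (countᶠ (g ∘ suc) + bit (f (suc k))) ≡⟨ sym (+-assoc (bit (g zero)) _ _) ⟩
  bit (g zero) + countᶠ (g ∘ suc) + bit (f (suc k))   ∎
  where open ≡-Reasoning

-- If f has fewer than x members, takeᶠ x f is all of f.
takeᶠ : ∀ {n} → ℕ → (Fin n → Bool) → Fin n → Bool
takeᶠ x f zero    = f zero ∧ (0 <ᵇ x)
takeᶠ x f (suc i) = takeᶠ (x ∸ bit (f zero)) (f ∘ suc) i

takeᶠ-⊆ : ∀ {n} x (f : Fin n → Bool) i → takeᶠ x f i ≡ true → f i ≡ true
takeᶠ-⊆ x f zero    e = ∧-true₁ e
takeᶠ-⊆ x f (suc i) e = takeᶠ-⊆ _ (f ∘ suc) i e

takeᶠ-mono : ∀ {n} x y (f : Fin n → Bool) i → x ≤ y → takeᶠ x f i ≡ true → takeᶠ y f i ≡ true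
takeᶠ-mono x y f zero le e with f zero
takeᶠ-mono (suc x) (suc y) f zero le e | true = refl
takeᶠ-mono x y f (suc i) le e = takeᶠ-mono _ _ (f ∘ suc) i (∸-monoˡ-≤ (bit (f zero)) le) e

countᶠ-takeᶠ : ∀ {n} x (f : Fin n → Bool) → x ≤ countᶠ f → countᶠ (takeᶠ x f) ≡ x
countᶠ-takeᶠ {zero}  zero f _ = refl
countᶠ-takeᶠ {suc n} x f le with f zero
countᶠ-takeᶠ {suc n} zero    f _        | true  = countᶠ-takeᶠ 0 (f ∘ suc) z≤n
countᶠ-takeᶠ {suc n} (suc x) f (s≤s le) | true  = cong suc (countᶠ-takeᶠ x (f ∘ suc) le)
countᶠ-takeᶠ {suc n} x       f le       | false = countᶠ-takeᶠ x (f ∘ suc) le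

⊆-contra : ∀ {n} {f g : Fin n → Bool} → (∀ i → f i ≡ true → g i ≡ true) → ∀ i → g i ≡ false → f i ≡ false
⊆-contra {f = f} f⊆g i gi with f i in fi
... | false = refl
... | true  = ⊥-elim (true≢false (trans (sym (f⊆g i fi)) gi))

pick : ∀ {n} → ℕ → ℕ → (Fin n → Bool) → (Fin n → Bool) → Fin n → Bool
pick x y A B i = takeᶠ x A i ∨ takeᶠ y B i

module _ {n} (Q A B : Fin n → Bool) (A⊆Q : ∀ i → A i ≡ true → Q i ≡ true) (B⊆¬Q : ∀ i → B i ≡ true → not (Q i) ≡ true) where

  private
    takeA⊆Q : ∀ x i → takeᶠ x A i ≡ true → Q i ≡ true
    takeA⊆Q x i = A⊆Q i ∘ takeᶠ-⊆ x A i
    takeB⊆¬Q : ∀ y i → takeᶠ y B i ≡ true → not (Q i) ≡ true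
    takeB⊆¬Q y i = B⊆¬Q i ∘ takeᶠ-⊆ y B i

  pick-∧ : ∀ x y i → pick x y A B i ∧ Q i ≡ takeᶠ x A i
  pick-∧ x y i with Q i in qi
  ... | true  rewrite ⊆-contra (takeB⊆¬Q y) i (cong not qi) = trans (∧-identityʳ _) (∨-identityʳ _)
  ... | false rewrite ⊆-contra (takeA⊆Q x) i qi = ∧-zeroʳ _

  pick-∧not : ∀ x y i → pick x y A B i ∧ not (Q i) ≡ takeᶠ y B i
  pick-∧not x y i with Q i in qi
  ... | true  rewrite ⊆-contra (takeB⊆¬Q y) i (cong not qi) = ∧-zeroʳ _
  ... | false rewrite ⊆-contra (takeA⊆Q x) i qi = ∧-identityʳ _

  countᶠ-pick-∧ : ∀ x y → x ≤ countᶠ A → countᶠ (λ i → pick x y A B i ∧ Q i) ≡ x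
  countᶠ-pick-∧ x y x≤ = trans (countᶠ-cong (pick-∧ x y)) (countᶠ-takeᶠ x A x≤)

  countᶠ-pick-∧not : ∀ x y → y ≤ countᶠ B → countᶠ (λ i → pick x y A B i ∧ not (Q i)) ≡ y
  countᶠ-pick-∧not x y y≤ = trans (countᶠ-cong (pick-∧not x y)) (countᶠ-takeᶠ y B y≤)

pick-avoids : ∀ {n} x y (A B : Fin n → Bool) i → A i ≡ false → B i ≡ false → pick x y A B i ≡ false
pick-avoids x y A B i ai bi rewrite ⊆-contra (takeᶠ-⊆ x A) i ai | ⊆-contra (takeᶠ-⊆ y B) i bi = refl

pick-mono : ∀ {n} x x′ y y′ (A B : Fin n → Bool) i → x ≤ x′ → y ≤ y′ → pick x y A B i ≡ true → pick x′ y′ A B i ≡ true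
pick-mono x x′ y y′ A B i p q e with takeᶠ x A i in e₁
... | true  rewrite takeᶠ-mono x x′ A i p e₁ = refl
... | false rewrite takeᶠ-mono y y′ B i q e = ∨-zeroʳ (takeᶠ x′ A i)

countᶠ-add : ∀ {n} (f g : Fin n → Bool) k → (∀ i → i ≢ k → f i ≡ g i) → f k ≡ false → countᶠ f + bit (g k) ≡ countᶠ g
countᶠ-add f g k h fk = trans (countᶠ-update f g k h) (trans (cong (λ b → countᶠ g + bit b) fk) (+-identityʳ _))

insertᶠ : ∀ {n} → (Fin n → Bool) → Fin n → Fin n → Bool
insertᶠ s i k = s k ∨ (i ==ᶠ k)

deleteᶠ : ∀ {n} → (Fin n → Bool) → Fin n → Fin n → Bool
deleteᶠ s i k = s k ∧ not (i ==ᶠ k)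

insertᶠ-elsewhere : ∀ {n} (s : Fin n → Bool) l i → i ≢ l → insertᶠ s l i ≡ s i
insertᶠ-elsewhere s l i i≢l = trans (cong (s i ∨_) (≢⇒==ᶠ-false l i (i≢l ∘ sym))) (∨-identityʳ (s i))

deleteᶠ-elsewhere : ∀ {n} (s : Fin n → Bool) k i → i ≢ k → deleteᶠ s k i ≡ s i
deleteᶠ-elsewhere s k i i≢k = trans (cong (λ b → s i ∧ not b) (≢⇒==ᶠ-false k i (i≢k ∘ sym))) (∧-identityʳ (s i))

countᶠ-insertᶠ : ∀ {n} (s R : Fin n → Bool) l → s l ≡ false →
                 countᶠ (λ m → s m ∧ R m) + bit (R l) ≡ countᶠ (λ m → insertᶠ s l m ∧ R m)
countᶠ-insertᶠ s R l sl = subst (λ b → countᶠ (λ m → s m ∧ R m) + bit b ≡ countᶠ (λ m → insertᶠ s l m ∧ R m)) added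
  (countᶠ-add _ _ l (λ i ne → cong (_∧ R i) (sym (insertᶠ-elsewhere s l i ne))) (cong (_∧ R l) sl))
  where
  added : insertᶠ s l l ∧ R l ≡ R l
  added rewrite ==ᶠ-refl l | ∨-zeroʳ (s l) = refl

countᶠ-deleteᶠ : ∀ {n} (s R : Fin n → Bool) k → s k ≡ true →
                 countᶠ (λ m → deleteᶠ s k m ∧ R m) + bit (R k) ≡ countᶠ (λ m → s m ∧ R m)
countᶠ-deleteᶠ s R k sk = subst (λ b → countᶠ (λ m → deleteᶠ s k m ∧ R m) + bit b ≡ countᶠ (λ m → s m ∧ R m)) (cong (_∧ R k) sk)
  (countᶠ-add _ _ k (λ i ne → cong (_∧ R i) (deleteᶠ-elsewhere s k i ne)) removed)
  where
  removed : deleteᶠ s k k ∧ R k ≡ false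
  removed rewrite ==ᶠ-refl k | ∧-zeroʳ (s k) = refl

lookup-⁅⁆ : ∀ {n} (i k : Fin n) → lookup ⁅ i ⁆ k ≡ (i ==ᶠ k)
lookup-⁅⁆ zero    zero    = refl
lookup-⁅⁆ zero    (suc k) = lookup-replicate k false
lookup-⁅⁆ (suc i) zero    = refl
lookup-⁅⁆ (suc i) (suc k) = lookup-⁅⁆ i k

lookup-∪⁅⁆ : ∀ {n} (S : Subset n) i k → lookup (S ∪ ⁅ i ⁆) k ≡ insertᶠ (lookup S) i k
lookup-∪⁅⁆ S i k = trans (lookup-zipWith _∨_ k S ⁅ i ⁆) (cong (lookup S k ∨_) (lookup-⁅⁆ i k))

∉⇒lookup-false : ∀ {n} {i : Fin n} {S} → i ∉ S → lookup S i ≡ false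
∉⇒lookup-false {i = i} {S} i∉ with lookup S i in e
... | false = refl
... | true  = ⊥-elim (i∉ (lookup⇒[]= i S e))

lookup-false⇒∉ : ∀ {n} {i : Fin n} {S} → lookup S i ≡ false → i ∉ S
lookup-false⇒∉ e i∈ with trans (sym ([]=⇒lookup i∈)) e
... | ()

-- Lattice words

-- A word is a lattice path of right (true) and down (false) steps.  Read as a
-- monotone Boolean function on the grid [0, rights) × [0, downs), the cell
-- (x , d) is winning iff the (d+1)-st down step comes before the (x+1)-st right
-- step.  The second coordinate d counts players outside a coalition, so win is
-- increasing in x and decreasing in d.
Word : Set
Word = List Bool

rights : Word → ℕ
rights []          = 0
rights (true ∷ w)  = suc (rights w)
rights (false ∷ w) = rights w

downs : Word → ℕ
downs []          = 0
downs (true ∷ w)  = downs w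
downs (false ∷ w) = suc (downs w)

win : Word → ℕ → ℕ → Bool
win []          x       d       = false
win (false ∷ w) x       zero    = true
win (false ∷ w) x       (suc d) = win w x d
win (true ∷ w)  zero    d       = false
win (true ∷ w)  (suc x) d       = win w x d

length≡rights+downs : ∀ w → length w ≡ rights w + downs w
length≡rights+downs []          = refl
length≡rights+downs (true ∷ w)  = cong suc (length≡rights+downs w)
length≡rights+downs (false ∷ w) = trans (cong suc (length≡rights+downs w)) (sym (+-suc (rights w) (downs w)))

rights-++ : ∀ u v → rights (u ++ v) ≡ rights u + rights v
rights-++ []          v = refl
rights-++ (true ∷ u)  v = cong suc (rights-++ u v)
rights-++ (false ∷ u) v = rights-++ u v

downs-++ : ∀ u v → downs (u ++ v) ≡ downs u + downs v
downs-++ []          v = refl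
downs-++ (true ∷ u)  v = downs-++ u v
downs-++ (false ∷ u) v = cong suc (downs-++ u v)

rights-replicate-false : ∀ s → rights (replicate s false) ≡ 0
rights-replicate-false zero    = refl
rights-replicate-false (suc s) = rights-replicate-false s

downs-replicate-false : ∀ s → downs (replicate s false) ≡ s
downs-replicate-false zero    = refl
downs-replicate-false (suc s) = cong suc (downs-replicate-false s)

rights-replicate-true : ∀ s → rights (replicate s true) ≡ s
rights-replicate-true zero    = refl
rights-replicate-true (suc s) = cong suc (rights-replicate-true s)

downs-replicate-true : ∀ s → downs (replicate s true) ≡ 0
downs-replicate-true zero    = refl
downs-replicate-true (suc s) = downs-replicate-true s

rights≡0⇒replicate : ∀ w → rights w ≡ 0 → w ≡ replicate (length w) false
rights≡0⇒replicate []          _ = refl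
rights≡0⇒replicate (false ∷ w) e = cong (false ∷_) (rights≡0⇒replicate w e)

downs≡0⇒replicate : ∀ w → downs w ≡ 0 → w ≡ replicate (length w) true
downs≡0⇒replicate []         _ = refl
downs≡0⇒replicate (true ∷ w) e = cong (true ∷_) (downs≡0⇒replicate w e)

win-sucˣ : ∀ w x d → win w x d ≡ true → win w (suc x) d ≡ true
win-sucˣ (false ∷ w) x       zero    _ = refl
win-sucˣ (false ∷ w) x       (suc d) h = win-sucˣ w x d h
win-sucˣ (true ∷ w)  (suc x) d       h = win-sucˣ w x d h

win-predᵈ : ∀ w x d → win w x (suc d) ≡ true → win w x d ≡ true
win-predᵈ (false ∷ w) x       zero    _ = refl
win-predᵈ (false ∷ w) x       (suc d) h = win-predᵈ w x d h
win-predᵈ (true ∷ w)  (suc x) d       h = win-predᵈ w x d h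

win-mono′ : ∀ w {x x′ d d′} → x ≤′ x′ → d′ ≤′ d → win w x d ≡ true → win w x′ d′ ≡ true
win-mono′ w ≤′-refl     ≤′-refl     h = h
win-mono′ w ≤′-refl     (≤′-step q) h = win-mono′ w ≤′-refl q (win-predᵈ w _ _ h)
win-mono′ w (≤′-step p) q           h = win-sucˣ w _ _ (win-mono′ w p q h)

win-mono : ∀ w {x x′ d d′} → x ≤ x′ → d′ ≤ d → win w x d ≡ true → win w x′ d′ ≡ true
win-mono w p q = win-mono′ w (≤⇒≤′ p) (≤⇒≤′ q)

win-++ : ∀ u v x d → x < rights u ⊎ d < downs u → win (u ++ v) x d ≡ win u x d
win-++ []          v x d       (inj₁ ())
win-++ []          v x d       (inj₂ ())
win-++ (false ∷ u) v x zero    _                = refl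
win-++ (false ∷ u) v x (suc d) (inj₁ p)         = win-++ u v x d (inj₁ p)
win-++ (false ∷ u) v x (suc d) (inj₂ (s≤s p))   = win-++ u v x d (inj₂ p)
win-++ (true ∷ u)  v zero    d _                = refl
win-++ (true ∷ u)  v (suc x) d (inj₁ (s≤s p))   = win-++ u v x d (inj₁ p)
win-++ (true ∷ u)  v (suc x) d (inj₂ p)         = win-++ u v x d (inj₂ p)

win-pastRights : ∀ u x d → rights u ≤ x → d < downs u → win u x d ≡ true
win-pastRights (false ∷ u) x       zero    _       _       = refl
win-pastRights (false ∷ u) x       (suc d) p       (s≤s q) = win-pastRights u x d p q
win-pastRights (true ∷ u)  (suc x) d       (s≤s p) q       = win-pastRights u x d p q

win-pastDowns : ∀ u x d → x < rights u → downs u ≤ d → win u x d ≡ false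
win-pastDowns (false ∷ u) x       (suc d) p       (s≤s q) = win-pastDowns u x d p q
win-pastDowns (true ∷ u)  zero    d       _       _       = refl
win-pastDowns (true ∷ u)  (suc x) d       (s≤s p) q       = win-pastDowns u x d p q

win-injective : ∀ u v → rights u ≡ rights v → downs u ≡ downs v →
                (∀ x d → x < rights u → d < downs u → win u x d ≡ win v x d) → u ≡ v
win-injective []          []          _ _ _ = refl
win-injective (true ∷ u)  (true ∷ v)  p q h =
  cong (true ∷_) (win-injective u v (suc-injective p) q (λ x d x< d< → h (suc x) d (s≤s x<) d<))
win-injective (false ∷ u) (false ∷ v) p q h =
  cong (false ∷_) (win-injective u v p (suc-injective q) (λ x d x< d< → h x (suc d) x< (s≤s d<)))
win-injective (true ∷ u)  (false ∷ v) p q h with h 0 0 (s≤s z≤n) (subst (0 <_) (sym q) (s≤s z≤n))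
... | ()
win-injective (false ∷ u) (true ∷ v)  p q h with h 0 0 (subst (0 <_) (sym p) (s≤s z≤n)) (s≤s z≤n)
... | ()
win-injective []          (true ∷ v)  () _ _
win-injective []          (false ∷ v) _ () _
win-injective (true ∷ u)  []          () _ _
win-injective (false ∷ u) []          _ () _

-- Swapping the two classes of players turns a path into its reverse complement.
dual : Word → Word
dual w = reverse (map not w)

dual-∷ : ∀ c w → dual (c ∷ w) ≡ dual w ++ [ not c ]
dual-∷ c w = unfold-reverse (not c) (map not w)

dual-involutive : ∀ w → dual (dual w) ≡ w
dual-involutive w = begin
  reverse (map not (reverse (map not w))) ≡⟨ cong reverse (reverse-map not (map not w)) ⟩
  reverse (reverse (map not (map not w))) ≡⟨ reverse-involutive _ ⟩
  map not (map not w)                     ≡⟨ map-not-not w ⟩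
  w                                       ∎
  where
  open ≡-Reasoning
  map-not-not : ∀ w → map not (map not w) ≡ w
  map-not-not []      = refl
  map-not-not (c ∷ w) = cong₂ _∷_ (not-involutive c) (map-not-not w)

dual-++ : ∀ u v → dual (u ++ v) ≡ dual v ++ dual u
dual-++ u v = trans (cong reverse (map-++ not u v)) (reverse-++ (map not u) (map not v))

length-dual : ∀ w → length (dual w) ≡ length w
length-dual w = trans (length-reverse (map not w)) (length-map not w)

rights-dual : ∀ w → rights (dual w) ≡ downs w
downs-dual : ∀ w → downs (dual w) ≡ rights w
rights-dual []          = refl
rights-dual (true ∷ w)  = trans (cong rights (dual-∷ true w))
  (trans (rights-++ (dual w) [ false ]) (trans (+-identityʳ _) (rights-dual w)))
rights-dual (false ∷ w) = trans (cong rights (dual-∷ false w))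
  (trans (rights-++ (dual w) [ true ]) (trans (+-comm (rights (dual w)) 1) (cong suc (rights-dual w))))
downs-dual []          = refl
downs-dual (true ∷ w)  = trans (cong downs (dual-∷ true w))
  (trans (downs-++ (dual w) [ false ]) (trans (+-comm (downs (dual w)) 1) (cong suc (downs-dual w))))
downs-dual (false ∷ w) = trans (cong downs (dual-∷ false w))
  (trans (downs-++ (dual w) [ true ]) (trans (+-identityʳ _) (downs-dual w)))

∸≡suc∸suc : ∀ {x y} → x < y → y ∸ x ≡ suc (y ∸ suc x)
∸≡suc∸suc {zero}  {suc y} _       = refl
∸≡suc∸suc {suc x} {suc y} (s≤s p) = ∸≡suc∸suc p

-- The dual path is the original one rotated by a half turn.
win-dual : ∀ w x d → x < downs w → d < rights w →
           win (dual w) x d ≡ win w (rights w ∸ suc d) (downs w ∸ suc x)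
win-dual [] x d () _
win-dual (false ∷ u) x d p q = begin
  win (dual (false ∷ u)) x d ≡⟨ cong (λ z → win z x d) (dual-∷ false u) ⟩
  win (dual u ++ [ true ]) x d ≡⟨ win-++ (dual u) [ true ] x d (inj₂ (subst (d <_) (sym (downs-dual u)) q)) ⟩
  win (dual u) x d ≡⟨ lastStep (<-cmp x (downs u)) ⟩
  win (false ∷ u) (rights u ∸ suc d) (downs (false ∷ u) ∸ suc x) ∎
  where
  open ≡-Reasoning
  lastStep : Tri (x < downs u) (x ≡ downs u) (x > downs u) →
             win (dual u) x d ≡ win (false ∷ u) (rights u ∸ suc d) (suc (downs u) ∸ suc x)
  lastStep (tri< x<b _ _) = trans (win-dual u x d x<b q) (cong (win (false ∷ u) (rights u ∸ suc d)) (sym (∸≡suc∸suc x<b)))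
  lastStep (tri≈ _ refl _) = trans (win-pastRights (dual u) x d (≤-reflexive (rights-dual u)) (subst (d <_) (sym (downs-dual u)) q))
                                   (cong (win (false ∷ u) (rights u ∸ suc d)) (sym (n∸n≡0 (downs u))))
  lastStep (tri> _ _ x>b) = ⊥-elim (<⇒≱ p x>b)
win-dual (true ∷ u) x d p q = begin
  win (dual (true ∷ u)) x d ≡⟨ cong (λ z → win z x d) (dual-∷ true u) ⟩
  win (dual u ++ [ false ]) x d ≡⟨ win-++ (dual u) [ false ] x d (inj₁ (subst (x <_) (sym (rights-dual u)) p)) ⟩
  win (dual u) x d ≡⟨ lastStep (<-cmp d (rights u)) ⟩
  win (true ∷ u) (rights (true ∷ u) ∸ suc d) (downs u ∸ suc x) ∎
  where
  open ≡-Reasoning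
  lastStep : Tri (d < rights u) (d ≡ rights u) (d > rights u) →
             win (dual u) x d ≡ win (true ∷ u) (suc (rights u) ∸ suc d) (downs u ∸ suc x)
  lastStep (tri< d<a _ _) = trans (win-dual u x d p d<a) (cong (λ z → win (true ∷ u) z (downs u ∸ suc x)) (sym (∸≡suc∸suc d<a)))
  lastStep (tri≈ _ refl _) = trans (win-pastDowns (dual u) x d (subst (x <_) (sym (rights-dual u)) p) (≤-reflexive (downs-dual u)))
                                   (cong (λ z → win (true ∷ u) z (downs u ∸ suc x)) (sym (n∸n≡0 (rights u))))
  lastStep (tri> _ _ d>a) = ⊥-elim (<⇒≱ q d>a)

record MonotoneOn (r s : ℕ) (f : ℕ → ℕ → Bool) : Set where
  field
    sucˣ  : ∀ x d → suc x < r → d < s → f x d ≡ true → f (suc x) d ≡ true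
    predᵈ : ∀ x d → x < r → suc d < s → f x (suc d) ≡ true → f x d ≡ true

  row₀ : 0 < s → f 0 0 ≡ true → ∀ x → x < r → f x 0 ≡ true
  row₀ _  h zero    _ = h
  row₀ s> h (suc x) p = sucˣ x 0 p s> (row₀ s> h x (<⇒≤ p))

  column₀ : 0 < r → ∀ d → d < s → f 0 d ≡ true → f 0 0 ≡ true
  column₀ _  zero    _ h = h
  column₀ r> (suc d) p h = column₀ r> d (<⇒≤ p) (predᵈ 0 d r> p h)

open MonotoneOn

monotoneOn-tailˣ : ∀ {r s f} → MonotoneOn (suc r) s f → MonotoneOn r s (λ x d → f (suc x) d)
monotoneOn-tailˣ M = record
  { sucˣ  = λ x d a b → sucˣ M (suc x) d (s≤s a) b
  ; predᵈ = λ x d a b → predᵈ M (suc x) d (s≤s a) b }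

monotoneOn-tailᵈ : ∀ {r s f} → MonotoneOn r (suc s) f → MonotoneOn r s (λ x d → f x (suc d))
monotoneOn-tailᵈ M = record
  { sucˣ  = λ x d a b → sucˣ M x (suc d) a (s≤s b)
  ; predᵈ = λ x d a b → predᵈ M x (suc d) a (s≤s b) }

-- The path of a function on [0, r) × [0, s): at a corner cell that wins, the
-- whole first row wins and the path steps down; otherwise the whole first
-- column loses and it steps right.
encode : ℕ → ℕ → (ℕ → ℕ → Bool) → Word
encode zero    s       f = replicate s false
encode (suc r) zero    f = replicate (suc r) true
encode (suc r) (suc s) f with f 0 0
... | true  = false ∷ encode (suc r) s (λ x d → f x (suc d))
... | false = true ∷ encode r (suc s) (λ x d → f (suc x) d)

rights-encode : ∀ r s f → rights (encode r s f) ≡ r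
rights-encode zero    s       f = rights-replicate-false s
rights-encode (suc r) zero    f = rights-replicate-true (suc r)
rights-encode (suc r) (suc s) f with f 0 0
... | true  = rights-encode (suc r) s _
... | false = cong suc (rights-encode r (suc s) _)

downs-encode : ∀ r s f → downs (encode r s f) ≡ s
downs-encode zero    s       f = downs-replicate-false s
downs-encode (suc r) zero    f = downs-replicate-true (suc r)
downs-encode (suc r) (suc s) f with f 0 0
... | true  = cong suc (downs-encode (suc r) s _)
... | false = downs-encode r (suc s) _

length-encode : ∀ r s f → length (encode r s f) ≡ r + s
length-encode r s f = trans (length≡rights+downs (encode r s f)) (cong₂ _+_ (rights-encode r s f) (downs-encode r s f))

win-encode : ∀ r s f → MonotoneOn r s f → ∀ x d → x < r → d < s → win (encode r s f) x d ≡ f x d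
win-encode (suc r) (suc s) f M x d p q with f 0 0 in e₀₀
win-encode (suc r) (suc s) f M x zero p q | true =
  sym (row₀ M (s≤s z≤n) e₀₀ x p)
win-encode (suc r) (suc s) f M x (suc d) p (s≤s q) | true =
  win-encode (suc r) s _ (monotoneOn-tailᵈ M) x d p q
win-encode (suc r) (suc s) f M zero d p q | false with f 0 d in e₀d
... | false = refl
... | true  = ⊥-elim (true≢false (trans (sym (column₀ M (s≤s z≤n) d q e₀d)) e₀₀))
win-encode (suc r) (suc s) f M (suc x) d (s≤s p) q | false =
  win-encode r (suc s) _ (monotoneOn-tailˣ M) x d p q

-- Shift-invariant paths and threshold paths

-- Shift invariance is what makes the two classes of players equivalent.
ShiftInvariant : Word → Set
ShiftInvariant w = ∀ x d → suc x < rights w → suc d < downs w → win w (suc x) (suc d) ≡ win w x d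

shiftInvariantᵇ : Word → Bool
shiftInvariantᵇ w =
  all< (pred (rights w)) λ x → all< (pred (downs w)) λ d → win w (suc x) (suc d) == win w x d

shiftInvariantᵇ-sound : ∀ w → shiftInvariantᵇ w ≡ true → ShiftInvariant w
shiftInvariantᵇ-sound w e x d p q =
  ==⇒≡ _ _ (all<-sound _ _ (all<-sound _ _ e x (<⇒≤pred p)) d (<⇒≤pred q))

shiftInvariantᵇ-complete : ∀ w → ShiftInvariant w → shiftInvariantᵇ w ≡ true
shiftInvariantᵇ-complete w h = all<-complete _ _ λ x p → all<-complete _ _ λ d q →
  subst (λ z → (z == win w x d) ≡ true) (sym (h x d (pred< p) (pred< q))) (==-refl (win w x d))
  where
  pred< : ∀ {x r} → x < pred r → suc x < r
  pred< {r = suc r} p = s≤s p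

shiftInvariantᵇ-false : ∀ w → shiftInvariantᵇ w ≡ false → ¬ ShiftInvariant w
shiftInvariantᵇ-false w e si = true≢false (trans (sym (shiftInvariantᵇ-complete w si)) e)

shiftInvariant-dual : ∀ w → ShiftInvariant w → ShiftInvariant (dual w)
shiftInvariant-dual w h x d p q = begin
  win (dual w) (suc x) (suc d)         ≡⟨ win-dual w (suc x) (suc d) p′ q′ ⟩
  win w (r ∸ suc (suc d)) (s ∸ suc (suc x)) ≡⟨ sym (h _ _ (subst (_< r) (∸≡suc∸suc q′) (∸-monoʳ-< (s≤s z≤n) (<⇒≤ q′)))
                                                           (subst (_< s) (∸≡suc∸suc p′) (∸-monoʳ-< (s≤s z≤n) (<⇒≤ p′)))) ⟩
  win w (suc (r ∸ suc (suc d))) (suc (s ∸ suc (suc x))) ≡⟨ cong₂ (win w) (sym (∸≡suc∸suc q′)) (sym (∸≡suc∸suc p′)) ⟩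
  win w (r ∸ suc d) (s ∸ suc x)        ≡⟨ sym (win-dual w x d (<⇒≤ p′) (<⇒≤ q′)) ⟩
  win (dual w) x d                     ∎
  where
  open ≡-Reasoning
  r = rights w
  s = downs w
  p′ : suc x < s
  p′ = subst (suc x <_) (rights-dual w) p
  q′ : suc d < r
  q′ = subst (suc d <_) (downs-dual w) q

shiftInvariant-dual⁻ : ∀ w → ShiftInvariant (dual w) → ShiftInvariant w
shiftInvariant-dual⁻ w si = subst ShiftInvariant (dual-involutive w) (shiftInvariant-dual (dual w) si)

threshold : ℕ → ℕ → ℕ → ℕ → Bool
threshold s k x d = d + k <ᵇ x + s

threshold-monotoneOn : ∀ r s k → MonotoneOn r s (threshold s k)
threshold-monotoneOn r s k = record
  { sucˣ  = λ x d _ _ h → <ᵇ-true (≤-trans (<ᵇ-true⁻ {d + k} {x + s} h) (n≤1+n _))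
  ; predᵈ = λ x d _ _ h → <ᵇ-true (<⇒≤ (<ᵇ-true⁻ {suc d + k} {x + s} h)) }

stair : ℕ → ℕ → ℕ → Word
stair r s k = encode r s (threshold s k)

win-stair : ∀ r s k x d → x < r → d < s → win (stair r s k) x d ≡ threshold s k x d
win-stair r s k = win-encode r s (threshold s k) (threshold-monotoneOn r s k)

stair-shiftInvariant : ∀ r s k → ShiftInvariant (stair r s k)
stair-shiftInvariant r s k x d p q =
  trans (win-stair r s k (suc x) (suc d) p′ q′) (sym (win-stair r s k x d (<⇒≤ p′) (<⇒≤ q′)))
  where
  p′ : suc x < r
  p′ = subst (suc x <_) (rights-encode r s _) p
  q′ : suc d < s
  q′ = subst (suc d <_) (downs-encode r s _) q

-- A cell won under threshold k but lost under every larger one.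
threshold-boundaryCell : ∀ r s k → 0 < r → 0 < s → suc k < r + s →
                         Σ ℕ λ x → Σ ℕ λ d → x < r × d < s × x + s ≡ suc (d + k)
threshold-boundaryCell r s k r> s> k< with k <? s
... | yes k<s = 0 , s ∸ suc k , r> , ∸-monoʳ-< (s≤s z≤n) k<s ,
                trans (sym (m∸n+n≡m k<s)) (+-suc (s ∸ suc k) k)
... | no  k≮s = suc k ∸ s , 0 , +-cancelʳ-< s (suc k ∸ s) r (subst (_< r + s) (sym x+s) k<) , s> , x+s
  where
  x+s : suc k ∸ s + s ≡ suc k
  x+s = m∸n+n≡m (≤-trans (≮⇒≥ k≮s) (n≤1+n k))

stair-separates : ∀ r s k k′ → 0 < r → 0 < s → k < k′ → k′ < r + s → stair r s k ≢ stair r s k′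
stair-separates r s k k′ r> s> k<k′ k′< e with threshold-boundaryCell r s k r> s> (≤-<-trans k<k′ k′<)
... | x , d , x<r , d<s , x+s = true≢false (begin
  true                   ≡⟨ sym (<ᵇ-true (≤-reflexive (sym x+s))) ⟩
  threshold s k x d      ≡⟨ sym (win-stair r s k x d x<r d<s) ⟩
  win (stair r s k) x d  ≡⟨ cong (λ z → win z x d) e ⟩
  win (stair r s k′) x d ≡⟨ win-stair r s k′ x d x<r d<s ⟩
  threshold s k′ x d     ≡⟨ <ᵇ-false (subst (_≤ d + k′) (trans (+-suc d k) (sym x+s)) (+-monoʳ-≤ d k<k′)) ⟩
  false                  ∎)
  where open ≡-Reasoning

stair-injective : ∀ r s k k′ → 0 < r → 0 < s → k < r + s → k′ < r + s → stair r s k ≡ stair r s k′ → k ≡ k′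
stair-injective r s k k′ r> s> k< k′< e with <-cmp k k′
... | tri≈ _ k≡k′ _ = k≡k′
... | tri< k<k′ _ _ = ⊥-elim (stair-separates r s k k′ r> s> k<k′ k′< e)
... | tri> _ _ k>k′ = ⊥-elim (stair-separates r s k′ k r> s> k>k′ k< (sym e))

threshold-halfTurn : ∀ r k x d → x < r → d < r → threshold r k (r ∸ suc d) (r ∸ suc x) ≡ threshold r k x d
threshold-halfTurn r k x d x<r d<r =
  <ᵇ-shift (Q + k) (P + r) (d + k) (x + r) (suc x + d) r (shift₁ Q k x d r (m∸n+n≡m x<r)) (shift₂ P r x d (m∸n+n≡m d<r))
  where
  P = r ∸ suc d
  Q = r ∸ suc x
  shift₁ : ∀ q k x d r → q + suc x ≡ r → q + k + (suc x + d) ≡ d + k + r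
  shift₁ q k x d r refl = ring q k x d
    where
    ring : ∀ q k x d → q + k + (suc x + d) ≡ d + k + (q + suc x)
    ring = solve-∀
  shift₂ : ∀ p r x d → p + suc d ≡ r → p + r + (suc x + d) ≡ x + r + r
  shift₂ p r x d refl = ring p x d
    where
    ring : ∀ p x d → p + (p + suc d) + (suc x + d) ≡ x + (p + suc d) + (p + suc d)
    ring = solve-∀

dual-stair : ∀ r k → dual (stair r r k) ≡ stair r r k
dual-stair r k = win-injective (dual st) st
  (trans (rights-dual st) (trans (downs-encode r r _) (sym (rights-encode r r _))))
  (trans (downs-dual st) (trans (rights-encode r r _) (sym (downs-encode r r _))))
  sameCells
  where
  st = stair r r k
  sameCells : ∀ x d → x < rights (dual st) → d < downs (dual st) → win (dual st) x d ≡ win st x d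
  sameCells x d p q = begin
    win (dual st) x d                         ≡⟨ win-dual st x d (subst (x <_) (rights-dual st) p) (subst (d <_) (downs-dual st) q) ⟩
    win st (rights st ∸ suc d) (downs st ∸ suc x) ≡⟨ cong₂ (λ a b → win st (a ∸ suc d) (b ∸ suc x)) (rights-encode r r _) (downs-encode r r _) ⟩
    win st (r ∸ suc d) (r ∸ suc x)            ≡⟨ win-stair r r k _ _ (∸-monoʳ-< (s≤s z≤n) d<r) (∸-monoʳ-< (s≤s z≤n) x<r) ⟩
    threshold r k (r ∸ suc d) (r ∸ suc x)     ≡⟨ threshold-halfTurn r k x d x<r d<r ⟩
    threshold r k x d                         ≡⟨ sym (win-stair r r k x d x<r d<r) ⟩
    win st x d                                ∎
    where
    open ≡-Reasoning
    x<r : x < r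
    x<r = subst (x <_) (trans (rights-dual st) (downs-encode r r _)) p
    d<r : d < r
    d<r = subst (d <_) (trans (downs-dual st) (rights-encode r r _)) q

win-shift : ∀ w → ShiftInvariant w → ∀ x d → x < rights w → d < downs w → win w x d ≡ win w (x ∸ d) (d ∸ x)
win-shift w si zero    zero    _ _ = refl
win-shift w si zero    (suc d) _ _ = refl
win-shift w si (suc x) zero    _ _ = refl
win-shift w si (suc x) (suc d) p q = trans (si x d p q) (win-shift w si x d (<⇒≤ p) (<⇒≤ q))

-- The cells of a path on its top row and left column, read along the boundary
-- from the bottom-left corner (s′ = downs − 1) to the top-right one.
boundary : Word → ℕ → ℕ → Bool
boundary w s′ p = win w (p ∸ s′) (s′ ∸ p)

boundary-upClosed : ∀ w s′ p → boundary w s′ p ≡ true → boundary w s′ (suc p) ≡ true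
boundary-upClosed w s′ p = win-mono w (∸-monoˡ-≤ s′ (n≤1+n p)) (∸-monoʳ-≤ s′ (n≤1+n p))

-- A shift-invariant path is determined by its boundary, which is monotone.
shiftInvariant⇒stair : ∀ w → ShiftInvariant w → 0 < downs w →
                       Σ ℕ λ k → k < rights w + downs w × w ≡ stair (rights w) (downs w) k
shiftInvariant⇒stair w si s>
  with upClosed⇒threshold (rights w + pred (downs w)) (boundary w (pred (downs w))) (boundary-upClosed w _)
... | k , k≤ , onBoundary =
  k , k<r+s , win-injective w (stair r s k) (sym (rights-encode r s _)) (sym (downs-encode r s _)) sameCells
  where
  r = rights w
  s = downs w
  s′ = pred s
  1+s′ : suc s′ ≡ s
  1+s′ = suc-pred s {{>-nonZero s>}}
  k<r+s : k < r + s
  k<r+s = subst (k <_) (trans (sym (+-suc r s′)) (cong (r +_) 1+s′)) (s≤s k≤)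
  sameCells : ∀ x d → x < r → d < s → win w x d ≡ win (stair r s k) x d
  sameCells x d x<r d<s = begin
    win w x d             ≡⟨ win-shift w si x d x<r d<s ⟩
    win w (x ∸ d) (d ∸ x) ≡⟨ sym (cong₂ (win w) (diagonalˣ x e d e+d) (diagonalᵈ x e d e+d)) ⟩
    boundary w s′ (x + e) ≡⟨ onBoundary (x + e) (+-mono-<-≤ x<r (m∸n≤m s′ d)) ⟩
    (k <ᵇ suc (x + e))    ≡⟨ <ᵇ-shift k _ (d + k) (x + s) d 0 (+-comm′ k d) (shift x e d e+d 1+s′) ⟩
    threshold s k x d     ≡⟨ sym (win-stair r s k x d x<r d<s) ⟩
    win (stair r s k) x d ∎
    where
    open ≡-Reasoning
    e = s′ ∸ d
    e+d : e + d ≡ s′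
    e+d = m∸n+n≡m (<⇒≤pred d<s)
    diagonalˣ : ∀ x e d {s′} → e + d ≡ s′ → (x + e) ∸ s′ ≡ x ∸ d
    diagonalˣ x e d refl = trans (cong (_∸ (e + d)) (+-comm x e)) ([m+n]∸[m+o]≡n∸o e x d)
    diagonalᵈ : ∀ x e d {s′} → e + d ≡ s′ → s′ ∸ (x + e) ≡ d ∸ x
    diagonalᵈ x e d refl = trans (cong ((e + d) ∸_) (+-comm x e)) ([m+n]∸[m+o]≡n∸o e d x)
    +-comm′ : ∀ k d → k + d ≡ d + k + 0
    +-comm′ = solve-∀
    shift : ∀ x e d {s′ s} → e + d ≡ s′ → suc s′ ≡ s → suc (x + e) + d ≡ x + s + 0
    shift x e d refl refl = ring x e d
      where
      ring : ∀ x e d → suc (x + e) + d ≡ x + suc (e + d) + 0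
      ring = solve-∀

words : ℕ → List Word
words zero    = [ [] ]
words (suc m) = map (true ∷_) (words m) ++ map (false ∷_) (words m)

length-words : ∀ m → length (words m) ≡ 2 ^ m
length-words zero    = refl
length-words (suc m) = begin
  length (map (true ∷_) (words m) ++ map (false ∷_) (words m))      ≡⟨ length-++ (map (true ∷_) (words m)) ⟩
  length (map (true ∷_) (words m)) + length (map (false ∷_) (words m)) ≡⟨ cong₂ _+_ (length-map _ (words m)) (length-map _ (words m)) ⟩
  length (words m) + length (words m)                                 ≡⟨ cong₂ _+_ (length-words m) (length-words m) ⟩
  2 ^ m + 2 ^ m                                                       ≡⟨ cong (2 ^ m +_) (sym (+-identityʳ (2 ^ m))) ⟩
  2 ^ suc m                                                           ∎
  where open ≡-Reasoning

∈-words⁻ : ∀ m {w} → w ∈ words m → length w ≡ m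
∈-words⁻ zero    (here refl) = refl
∈-words⁻ (suc m) w∈ with ∈-++⁻ (map (true ∷_) (words m)) w∈
... | inj₁ w∈₁ with ∈-map⁻ (true ∷_) w∈₁
...   | u , u∈ , refl = cong suc (∈-words⁻ m u∈)
∈-words⁻ (suc m) w∈ | inj₂ w∈₂ with ∈-map⁻ (false ∷_) w∈₂
...   | u , u∈ , refl = cong suc (∈-words⁻ m u∈)

∈-words⁺ : ∀ m {w} → length w ≡ m → w ∈ words m
∈-words⁺ _ {[]}        refl = here refl
∈-words⁺ _ {true ∷ w}  refl = ∈-++⁺ˡ (∈-map⁺ (true ∷_) (∈-words⁺ _ refl))
∈-words⁺ _ {false ∷ w} refl = ∈-++⁺ʳ (map (true ∷_) (words (length w))) (∈-map⁺ (false ∷_) (∈-words⁺ _ refl))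

words-unique : ∀ m → Unique (words m)
words-unique zero    = [] ∷ []
words-unique (suc m) = Unique.++⁺ (Unique.map⁺ ∷-injectiveʳ (words-unique m)) (Unique.map⁺ ∷-injectiveʳ (words-unique m)) disjoint
  where
  disjoint : ∀ {v} → v ∈ map (true ∷_) (words m) × v ∈ map (false ∷_) (words m) → ⊥
  disjoint (v∈₁ , v∈₂) with ∈-map⁻ (true ∷_) v∈₁ | ∈-map⁻ (false ∷_) v∈₂
  ... | _ , _ , refl | _ , _ , ()

-- Self-dual words

selfDualᵇ : Word → Bool
selfDualᵇ w = does (≡-dec Bool._≟_ w (dual w))

selfDualᵇ-sound : ∀ w → selfDualᵇ w ≡ true → w ≡ dual w
selfDualᵇ-sound w e with ≡-dec Bool._≟_ w (dual w)
... | yes p = p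

selfDualᵇ-complete : ∀ w → w ≡ dual w → selfDualᵇ w ≡ true
selfDualᵇ-complete w p with ≡-dec Bool._≟_ w (dual w)
... | yes _ = refl
... | no ¬p = ⊥-elim (¬p p)

selfDual⇒length≡rights+rights : ∀ w → w ≡ dual w → length w ≡ rights w + rights w
selfDual⇒length≡rights+rights w e =
  trans (length≡rights+downs w) (cong (rights w +_) (trans (sym (rights-dual w)) (cong rights (sym e))))

selfDual⇒downs≡rights : ∀ w → w ≡ dual w → downs w ≡ rights w
selfDual⇒downs≡rights w e = trans (sym (rights-dual w)) (cong rights (sym e))

countᵇ-selfDual-odd : ∀ j → countᵇ selfDualᵇ (words (suc (j + j))) ≡ 0
countᵇ-selfDual-odd j = countᵇ-none selfDualᵇ (words (suc (j + j))) notSelfDual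
  where
  notSelfDual : ∀ w → w ∈ words (suc (j + j)) → selfDualᵇ w ≡ false
  notSelfDual w w∈ with selfDualᵇ w in e
  ... | false = refl
  ... | true  = ⊥-elim (odd≢even j (rights w) (trans (sym (∈-words⁻ _ w∈)) (selfDual⇒length≡rights+rights w (selfDualᵇ-sound w e))))

selfDual⇒halves : ∀ h w → length w ≡ h + h → w ≡ dual w → length (take h w) ≡ h × w ≡ take h w ++ dual (take h w)
selfDual⇒halves h w length-w selfDual = length-u , trans (sym u++v) (cong (u ++_) (proj₂ (++-injective u (dual v) v (dual u)
                                           (trans length-u (sym (trans (length-dual v) length-v))) halves)))
  where
  u = take h w
  v = drop h w
  length-u : length u ≡ h
  length-u = trans (length-take h w) (trans (cong (h ⊓_) length-w) (m≤n⇒m⊓n≡m (m≤m+n h h)))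
  length-v : length v ≡ h
  length-v = trans (length-drop h w) (trans (cong (_∸ h) length-w) (m+n∸m≡n h h))
  u++v : u ++ v ≡ w
  u++v = take++drop≡id h w
  halves : u ++ v ≡ dual v ++ dual u
  halves = trans u++v (trans selfDual (trans (cong dual (sym u++v)) (dual-++ u v)))

doubled : Word → Word
doubled u = u ++ dual u

length-doubled : ∀ u → length (doubled u) ≡ length u + length u
length-doubled u = trans (length-++ u) (cong (length u +_) (length-dual u))

doubled-selfDual : ∀ u → doubled u ≡ dual (doubled u)
doubled-selfDual u = sym (trans (dual-++ u (dual u)) (cong (_++ dual u) (dual-involutive u)))

countᵇ-selfDual-even : ∀ h → countᵇ selfDualᵇ (words (h + h)) ≡ 2 ^ h
countᵇ-selfDual-even h = begin
  countᵇ selfDualᵇ (words (h + h))           ≡⟨ sym (length-filterᵇ selfDualᵇ (words (h + h))) ⟩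
  length (filterᵇ selfDualᵇ (words (h + h))) ≡⟨ sameMembers⇒length≡ (Unique-filterᵇ selfDualᵇ (words-unique (h + h))) u-doubles toHalves toDoubled ⟩
  length (map doubled (words h))             ≡⟨ length-map doubled (words h) ⟩
  length (words h)                           ≡⟨ length-words h ⟩
  2 ^ h                                      ∎
  where
  open ≡-Reasoning
  u-doubles : Unique (map doubled (words h))
  u-doubles = Unique-map-injectiveOn doubled (words h)
    (λ {x} {y} _ _ e → proj₁ (++-injective x y (dual x) (dual y)
      (+-self-injective _ _ (trans (sym (length-doubled x)) (trans (cong length e) (length-doubled y)))) e))
    (words-unique h)
  toHalves : ∀ {w} → w ∈ filterᵇ selfDualᵇ (words (h + h)) → w ∈ map doubled (words h)
  toHalves {w} w∈ with ∈-filterᵇ⁻ selfDualᵇ w∈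
  ... | w∈words , sd with selfDual⇒halves h w (∈-words⁻ (h + h) w∈words) (selfDualᵇ-sound w sd)
  ...   | length-u , w≡ = subst (_∈ map doubled (words h)) (sym w≡) (∈-map⁺ doubled (∈-words⁺ h {take h w} length-u))
  toDoubled : ∀ {w} → w ∈ map doubled (words h) → w ∈ filterᵇ selfDualᵇ (words (h + h))
  toDoubled w∈ with ∈-map⁻ doubled w∈
  ... | u , u∈ , refl = ∈-filterᵇ⁺ selfDualᵇ
    (∈-words⁺ (h + h) (trans (length-doubled u) (cong₂ _+_ (∈-words⁻ h u∈) (∈-words⁻ h u∈))))
    (selfDualᵇ-complete (doubled u) (doubled-selfDual u))

stairOfLength : ℕ → ℕ × ℕ → Word
stairOfLength m (r , k) = stair r (m ∸ r) k

innerIndices : ℕ → List (ℕ × ℕ)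
innerIndices m = cartesianProduct (map suc (upTo (pred m))) (upTo m)

-- Besides the two constant paths, the shift-invariant words of length m are the
-- threshold paths with 0 < r < m rights and threshold k < m.
shiftInvariantWords : ℕ → List Word
shiftInvariantWords m = replicate m false ∷ replicate m true ∷ map (stairOfLength m) (innerIndices m)

∈-innerIndices⁻ : ∀ m {r k} → (r , k) ∈ innerIndices m → 0 < r × r < m × k < m
∈-innerIndices⁻ (suc m) rk∈ with ∈-cartesianProduct⁻ (map suc (upTo m)) (upTo (suc m)) rk∈
... | r∈ , k∈ with ∈-map⁻ suc r∈
...   | i , i∈ , refl = s≤s z≤n , s≤s (∈-upTo⁻ i∈) , ∈-upTo⁻ k∈

∈-innerIndices⁺ : ∀ m {r k} → 0 < r → r < m → k < m → (r , k) ∈ innerIndices m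
∈-innerIndices⁺ (suc m) {suc r} _ (s≤s r<m) k<m =
  ∈-cartesianProduct⁺ (∈-map⁺ suc (∈-upTo⁺ r<m)) (∈-upTo⁺ k<m)

length-shiftInvariantWords : ∀ m → length (shiftInvariantWords m) ≡ 2 + pred m * m
length-shiftInvariantWords m = cong (2 +_) (begin
  length (map (stairOfLength m) (innerIndices m))              ≡⟨ length-map (stairOfLength m) (innerIndices m) ⟩
  length (innerIndices m)                                      ≡⟨ length-cartesianProduct (map suc (upTo (pred m))) (upTo m) ⟩
  length (map suc (upTo (pred m))) * length (upTo m)            ≡⟨ cong₂ _*_ (trans (length-map suc (upTo (pred m))) (length-upTo (pred m))) (length-upTo m) ⟩
  pred m * m                                                   ∎)
  where open ≡-Reasoning

rights-stairOfLength : ∀ m rk → rights (stairOfLength m rk) ≡ proj₁ rk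
rights-stairOfLength m (r , k) = rights-encode r (m ∸ r) _

∈-stairs⁻ : ∀ m {w} → w ∈ map (stairOfLength m) (innerIndices m) → 0 < rights w × rights w < m
∈-stairs⁻ m w∈ with ∈-map⁻ (stairOfLength m) w∈
... | (r , k) , rk∈ , refl with ∈-innerIndices⁻ m rk∈
...   | 0<r , r<m , _ = subst (0 <_) (sym (rights-stairOfLength m (r , k))) 0<r ,
                        subst (_< m) (sym (rights-stairOfLength m (r , k))) r<m

shiftInvariantWords-unique : ∀ m → 0 < m → Unique (shiftInvariantWords m)
shiftInvariantWords-unique m m> =
  All.tabulate (λ w∈ e → noRights w∈ (cong rights e)) ∷ All.tabulate (λ w∈ e → allRights w∈ (cong rights e))
  ∷ Unique-map-injectiveOn (stairOfLength m) (innerIndices m) stairOfLength-injective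
      (Unique.cartesianProduct⁺ (Unique.map⁺ suc-injective (Unique.upTo⁺ (pred m))) (Unique.upTo⁺ m))
  where
  noRights : ∀ {w} → w ∈ replicate m true ∷ map (stairOfLength m) (innerIndices m) → rights (replicate m false) ≢ rights w
  noRights (here refl) e = <-irrefl (trans (sym (rights-replicate-false m)) (trans e (rights-replicate-true m))) m>
  noRights (there w∈)  e = <-irrefl (trans (sym (rights-replicate-false m)) e) (proj₁ (∈-stairs⁻ m w∈))
  allRights : ∀ {w} → w ∈ map (stairOfLength m) (innerIndices m) → rights (replicate m true) ≢ rights w
  allRights w∈ e = <-irrefl (trans (sym e) (rights-replicate-true m)) (proj₂ (∈-stairs⁻ m w∈))
  stairOfLength-injective : ∀ {x y} → x ∈ innerIndices m → y ∈ innerIndices m → stairOfLength m x ≡ stairOfLength m y → x ≡ y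
  stairOfLength-injective {r , k} {r′ , k′} x∈ y∈ e
    with trans (sym (rights-stairOfLength m (r , k))) (trans (cong rights e) (rights-stairOfLength m (r′ , k′)))
  ... | refl with ∈-innerIndices⁻ m x∈ | ∈-innerIndices⁻ m y∈
  ...   | 0<r , r<m , k<m | _ , _ , k′<m =
    cong (r ,_) (stair-injective r (m ∸ r) k k′ 0<r (m<n⇒0<n∸m r<m) (subst (k <_) r+[m∸r] k<m) (subst (k′ <_) r+[m∸r] k′<m) e)
    where
    r+[m∸r] : m ≡ r + (m ∸ r)
    r+[m∸r] = sym (m+[n∸m]≡n (<⇒≤ r<m))

shiftInvariant⇒∈shiftInvariantWords : ∀ w → ShiftInvariant w → w ∈ shiftInvariantWords (length w)
shiftInvariant⇒∈shiftInvariantWords w si with rights w ≟ 0 | downs w ≟ 0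
... | yes r≡0 | _       = here (rights≡0⇒replicate w r≡0)
... | no  _   | yes d≡0 = there (here (downs≡0⇒replicate w d≡0))
... | no  r≢0 | no  d≢0 with shiftInvariant⇒stair w si (n≢0⇒n>0 d≢0)
...   | k , k< , w≡ = there (there (subst (_∈ map (stairOfLength m) (innerIndices m)) (sym w≡stair)
                        (∈-map⁺ (stairOfLength m) (∈-innerIndices⁺ m (n≢0⇒n>0 r≢0) r<m (subst (k <_) r+s≡m k<)))))
  where
  m = length w
  r+s≡m : rights w + downs w ≡ m
  r+s≡m = sym (length≡rights+downs w)
  r<m : rights w < m
  r<m = subst (rights w <_) r+s≡m (m<m+n (rights w) (n≢0⇒n>0 d≢0))
  w≡stair : w ≡ stairOfLength m (rights w , k)
  w≡stair = trans w≡ (cong (λ b → stair (rights w) b k) (trans (sym (m+n∸m≡n (rights w) (downs w))) (cong (_∸ rights w) r+s≡m)))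

∈shiftInvariantWords⇒shiftInvariant : ∀ m {w} → w ∈ shiftInvariantWords m → length w ≡ m × ShiftInvariant w
∈shiftInvariantWords⇒shiftInvariant m (here refl) =
  length-replicate m , λ x d p _ → ⊥-elim (<⇒≱ p (subst (_≤ suc x) (sym (rights-replicate-false m)) z≤n))
∈shiftInvariantWords⇒shiftInvariant m (there (here refl)) =
  length-replicate m , λ x d _ q → ⊥-elim (<⇒≱ q (subst (_≤ suc d) (sym (downs-replicate-true m)) z≤n))
∈shiftInvariantWords⇒shiftInvariant m (there (there w∈)) with ∈-map⁻ (stairOfLength m) w∈
... | (r , k) , rk∈ , refl =
  trans (length-encode r (m ∸ r) _) (m+[n∸m]≡n (<⇒≤ (proj₁ (proj₂ (∈-innerIndices⁻ m rk∈))))) ,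
  stair-shiftInvariant r (m ∸ r) k

countᵇ-shiftInvariant : ∀ m → 0 < m → countᵇ shiftInvariantᵇ (words m) ≡ 2 + pred m * m
countᵇ-shiftInvariant m m> = begin
  countᵇ shiftInvariantᵇ (words m)           ≡⟨ sym (length-filterᵇ shiftInvariantᵇ (words m)) ⟩
  length (filterᵇ shiftInvariantᵇ (words m)) ≡⟨ sameMembers⇒length≡ (Unique-filterᵇ shiftInvariantᵇ (words-unique m))
                                                  (shiftInvariantWords-unique m m>) classify enumerate ⟩
  length (shiftInvariantWords m)             ≡⟨ length-shiftInvariantWords m ⟩
  2 + pred m * m                             ∎
  where
  open ≡-Reasoning
  classify : ∀ {w} → w ∈ filterᵇ shiftInvariantᵇ (words m) → w ∈ shiftInvariantWords m
  classify {w} w∈ with ∈-filterᵇ⁻ shiftInvariantᵇ w∈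
  ... | w∈m , si = subst (λ l → w ∈ shiftInvariantWords l) (∈-words⁻ m w∈m)
                     (shiftInvariant⇒∈shiftInvariantWords w (shiftInvariantᵇ-sound w si))
  enumerate : ∀ {w} → w ∈ shiftInvariantWords m → w ∈ filterᵇ shiftInvariantᵇ (words m)
  enumerate {w} w∈ with ∈shiftInvariantWords⇒shiftInvariant m w∈
  ... | length-w , si = ∈-filterᵇ⁺ shiftInvariantᵇ (∈-words⁺ m length-w) (shiftInvariantᵇ-complete w si)

-- A self-dual word has as many rights as downs.
selfDual-shiftInvariant⇒squareStair : ∀ h w → 0 < h → length w ≡ h + h → ShiftInvariant w → w ≡ dual w →
                                      Σ ℕ λ k → k < h + h × w ≡ stair h h k
selfDual-shiftInvariant⇒squareStair h w h> length-w si selfDual =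
  k , subst (k <_) (cong₂ _+_ rights≡h downs≡h) (proj₁ (proj₂ char)) ,
  trans (proj₂ (proj₂ char)) (cong₂ (λ a b → stair a b k) rights≡h downs≡h)
  where
  rights≡h : rights w ≡ h
  rights≡h = +-self-injective _ _ (trans (sym (selfDual⇒length≡rights+rights w selfDual)) length-w)
  downs≡h : downs w ≡ h
  downs≡h = trans (selfDual⇒downs≡rights w selfDual) rights≡h
  char : Σ ℕ λ k → k < rights w + downs w × w ≡ stair (rights w) (downs w) k
  char = shiftInvariant⇒stair w si (subst (0 <_) (sym downs≡h) h>)
  k = proj₁ char

countᵇ-shiftInvariant∧selfDual : ∀ h → 0 < h → countᵇ (λ w → shiftInvariantᵇ w ∧ selfDualᵇ w) (words (h + h)) ≡ h + h
countᵇ-shiftInvariant∧selfDual h h> = begin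
  countᵇ p (words (h + h))           ≡⟨ sym (length-filterᵇ p (words (h + h))) ⟩
  length (filterᵇ p (words (h + h))) ≡⟨ sameMembers⇒length≡ (Unique-filterᵇ p (words-unique (h + h))) u-stairs classify enumerate ⟩
  length (map (stair h h) (upTo (h + h))) ≡⟨ trans (length-map (stair h h) (upTo (h + h))) (length-upTo (h + h)) ⟩
  h + h                              ∎
  where
  open ≡-Reasoning
  p : Word → Bool
  p w = shiftInvariantᵇ w ∧ selfDualᵇ w
  u-stairs : Unique (map (stair h h) (upTo (h + h)))
  u-stairs = Unique-map-injectiveOn (stair h h) (upTo (h + h))
    (λ x∈ y∈ → stair-injective h h _ _ h> h> (∈-upTo⁻ x∈) (∈-upTo⁻ y∈)) (Unique.upTo⁺ (h + h))
  classify : ∀ {w} → w ∈ filterᵇ p (words (h + h)) → w ∈ map (stair h h) (upTo (h + h))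
  classify {w} w∈ with ∈-filterᵇ⁻ p w∈
  ... | w∈m , pw with selfDual-shiftInvariant⇒squareStair h w h> (∈-words⁻ (h + h) w∈m)
                        (shiftInvariantᵇ-sound w (∧-true₁ pw)) (selfDualᵇ-sound w (∧-true₂ {shiftInvariantᵇ w} pw))
  ...   | k , k< , refl = ∈-map⁺ (stair h h) (∈-upTo⁺ k<)
  enumerate : ∀ {w} → w ∈ map (stair h h) (upTo (h + h)) → w ∈ filterᵇ p (words (h + h))
  enumerate w∈ with ∈-map⁻ (stair h h) w∈
  ... | k , _ , refl = ∈-filterᵇ⁺ p (∈-words⁺ (h + h) (length-encode h h _))
    (cong₂ _∧_ (shiftInvariantᵇ-complete (stair h h k) (stair-shiftInvariant h h k))
               (selfDualᵇ-complete (stair h h k) (sym (dual-stair h k))))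

-- Canonical words

_≤ˡᵉˣ_ : Word → Word → Bool
[]          ≤ˡᵉˣ v           = true
(c ∷ u)     ≤ˡᵉˣ []          = false
(false ∷ u) ≤ˡᵉˣ (false ∷ v) = u ≤ˡᵉˣ v
(false ∷ u) ≤ˡᵉˣ (true ∷ v)  = true
(true ∷ u)  ≤ˡᵉˣ (false ∷ v) = false
(true ∷ u)  ≤ˡᵉˣ (true ∷ v)  = u ≤ˡᵉˣ v

≤ˡᵉˣ-refl : ∀ u → (u ≤ˡᵉˣ u) ≡ true
≤ˡᵉˣ-refl []          = refl
≤ˡᵉˣ-refl (true ∷ u)  = ≤ˡᵉˣ-refl u
≤ˡᵉˣ-refl (false ∷ u) = ≤ˡᵉˣ-refl u

≤ˡᵉˣ-total : ∀ u v → (u ≤ˡᵉˣ v) ≡ false → (v ≤ˡᵉˣ u) ≡ true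
≤ˡᵉˣ-total (c ∷ u)     []          _ = refl
≤ˡᵉˣ-total (false ∷ u) (false ∷ v) e = ≤ˡᵉˣ-total u v e
≤ˡᵉˣ-total (true ∷ u)  (false ∷ v) _ = refl
≤ˡᵉˣ-total (true ∷ u)  (true ∷ v)  e = ≤ˡᵉˣ-total u v e

≤ˡᵉˣ-antisym : ∀ u v → (u ≤ˡᵉˣ v) ≡ true → (v ≤ˡᵉˣ u) ≡ true → u ≡ v
≤ˡᵉˣ-antisym []          []          _ _ = refl
≤ˡᵉˣ-antisym (false ∷ u) (false ∷ v) e f = cong (false ∷_) (≤ˡᵉˣ-antisym u v e f)
≤ˡᵉˣ-antisym (true ∷ u)  (true ∷ v)  e f = cong (true ∷_) (≤ˡᵉˣ-antisym u v e f)

canonicalᵇ : Word → Bool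
canonicalᵇ w = not (shiftInvariantᵇ w) ∧ (w ≤ˡᵉˣ dual w)

shiftInvariantᵇ-dual : ∀ w → shiftInvariantᵇ (dual w) ≡ shiftInvariantᵇ w
shiftInvariantᵇ-dual w with shiftInvariantᵇ w in e | shiftInvariantᵇ (dual w) in e′
... | true  | true  = refl
... | false | false = refl
... | true  | false = ⊥-elim (shiftInvariantᵇ-false (dual w) e′ (shiftInvariant-dual w (shiftInvariantᵇ-sound w e)))
... | false | true  = ⊥-elim (shiftInvariantᵇ-false w e (shiftInvariant-dual⁻ w (shiftInvariantᵇ-sound (dual w) e′)))

-- Exactly one of w and dual w is ≤ˡᵉˣ the other, unless they coincide.
≤ˡᵉˣ-dual-pair : ∀ w → bit (w ≤ˡᵉˣ dual w) + bit (dual w ≤ˡᵉˣ dual (dual w)) ≡ 1 + bit (selfDualᵇ w)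
≤ˡᵉˣ-dual-pair w rewrite dual-involutive w with selfDualᵇ w in e
... | true rewrite sym (selfDualᵇ-sound w e) | ≤ˡᵉˣ-refl w = refl
... | false with w ≤ˡᵉˣ dual w in e₁ | dual w ≤ˡᵉˣ w in e₂
...   | true  | false = refl
...   | false | true  = refl
...   | true  | true  = ⊥-elim (true≢false (trans (sym (selfDualᵇ-complete w (≤ˡᵉˣ-antisym w (dual w) e₁ e₂))) e))
...   | false | false = ⊥-elim (true≢false (trans (sym (≤ˡᵉˣ-total w (dual w) e₁)) e₂))

-- Burnside for the involution dual on the words that are not shift-invariant.
countᵇ-canonical : ∀ m →
  countᵇ canonicalᵇ (words m) + countᵇ canonicalᵇ (words m) + countᵇ shiftInvariantᵇ (words m)
    + countᵇ (λ w → shiftInvariantᵇ w ∧ selfDualᵇ w) (words m)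
  ≡ 2 ^ m + countᵇ selfDualᵇ (words m)
countᵇ-canonical m = begin
  C + C + D + DF                     ≡⟨ cong (λ z → z + z + D + DF) (sym (countᵇ-filterᵇ varying below all)) ⟩
  C′ + C′ + D + DF                   ≡⟨ cong (λ z → z + D + DF) (countᵇ-involution dual below selfDualᵇ V dual-involutive
                                          (Unique-filterᵇ varying (words-unique m)) closed ≤ˡᵉˣ-dual-pair) ⟩
  length V + countᵇ selfDualᵇ V + D + DF ≡⟨ cong₂ (λ a b → a + b + D + DF) (length-filterᵇ varying all) (countᵇ-filterᵇ varying selfDualᵇ all) ⟩
  N + NF + D + DF                    ≡⟨ rearrange N NF D DF ⟩
  (D + N) + (DF + NF)                ≡⟨ cong₂ _+_ (trans (countᵇ-complement shiftInvariantᵇ all) (length-words m))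
                                               (sym (countᵇ-split shiftInvariantᵇ selfDualᵇ all)) ⟩
  2 ^ m + countᵇ selfDualᵇ all       ∎
  where
  open ≡-Reasoning
  all = words m
  varying below : Word → Bool
  varying w = not (shiftInvariantᵇ w)
  below w = w ≤ˡᵉˣ dual w
  V = filterᵇ varying all
  C  = countᵇ canonicalᵇ all
  C′ = countᵇ below V
  D  = countᵇ shiftInvariantᵇ all
  DF = countᵇ (λ w → shiftInvariantᵇ w ∧ selfDualᵇ w) all
  N  = countᵇ varying all
  NF = countᵇ (λ w → varying w ∧ selfDualᵇ w) all
  rearrange : ∀ a b c d → a + b + c + d ≡ (c + a) + (d + b)
  rearrange = solve-∀
  closed : ∀ {w} → w ∈ V → dual w ∈ V
  closed {w} w∈ with ∈-filterᵇ⁻ varying w∈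
  ... | w∈m , v = ∈-filterᵇ⁺ varying (∈-words⁺ m (trans (length-dual w) (∈-words⁻ m w∈m)))
                    (trans (cong not (shiftInvariantᵇ-dual w)) v)

-- Path games

inside : ∀ {n} → (Fin n → Bool) → (Fin n → Bool) → ℕ
inside Q s = countᶠ (λ i → s i ∧ Q i)

outside : ∀ {n} → (Fin n → Bool) → (Fin n → Bool) → ℕ
outside Q s = countᶠ (λ i → not (s i) ∧ not (Q i))

-- The game on the players split into the classes Q and ¬ Q evaluates a
-- coalition at the cell (members in Q , non-members in ¬ Q) of the path w.
pathGameᶠ : ∀ {n} → Word → (Fin n → Bool) → (Fin n → Bool) → Bool
pathGameᶠ w Q s = win w (inside Q s) (outside Q s)

pathGame : ∀ {n} → Word → (Fin n → Bool) → Game n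
pathGame w Q S = pathGameᶠ w Q (lookup S)

-- The grid of w has one cell per possible count in each class.
Fits : ∀ {n} → Word → (Fin n → Bool) → Set
Fits w Q = rights w ≡ suc (countᶠ Q) × downs w ≡ suc (countᶠ (not ∘ Q))

inside-cong : ∀ {n} (Q : Fin n → Bool) {s t} → (∀ k → s k ≡ t k) → inside Q s ≡ inside Q t
inside-cong Q h = countᶠ-cong (λ i → cong (_∧ Q i) (h i))

outside-cong : ∀ {n} (Q : Fin n → Bool) {s t} → (∀ k → s k ≡ t k) → outside Q s ≡ outside Q t
outside-cong Q h = countᶠ-cong (λ i → cong (λ b → not b ∧ not (Q i)) (h i))

pathGameᶠ-cong : ∀ {n} w (Q : Fin n → Bool) {s t} → (∀ k → s k ≡ t k) → pathGameᶠ w Q s ≡ pathGameᶠ w Q t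
pathGameᶠ-cong w Q h = cong₂ (win w) (inside-cong Q h) (outside-cong Q h)

pathGame-congᶜ : ∀ {n} w {Q Q′ : Fin n → Bool} → (∀ i → Q i ≡ Q′ i) → ∀ S → pathGame w Q S ≡ pathGame w Q′ S
pathGame-congᶜ w h S = cong₂ (win w) (countᶠ-cong (λ i → cong (lookup S i ∧_) (h i)))
                                     (countᶠ-cong (λ i → cong (λ b → not (lookup S i) ∧ not b) (h i)))

inside≤ : ∀ {n} (Q s : Fin n → Bool) → inside Q s ≤ countᶠ Q
inside≤ Q s = countᶠ-mono _ _ (λ i → ∧-true₂ {s i})

outside≤ : ∀ {n} (Q s : Fin n → Bool) → outside Q s ≤ countᶠ (not ∘ Q)
outside≤ Q s = countᶠ-mono _ _ (λ i → ∧-true₂ {not (s i)})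

inside+missing : ∀ {n} (Q s : Fin n → Bool) → inside Q s + countᶠ (λ i → not (s i) ∧ Q i) ≡ countᶠ Q
inside+missing Q s = sym (countᶠ-split s Q)

present+outside : ∀ {n} (Q s : Fin n → Bool) → countᶠ (λ i → s i ∧ not (Q i)) + outside Q s ≡ countᶠ (not ∘ Q)
present+outside Q s = sym (countᶠ-split s (not ∘ Q))

inside-insertᶠ : ∀ {n} (Q s : Fin n → Bool) i → s i ≡ false → inside Q (insertᶠ s i) ≡ inside Q s + bit (Q i)
inside-insertᶠ Q s i si = sym (countᶠ-insertᶠ s Q i si)

outside-insertᶠ : ∀ {n} (Q s : Fin n → Bool) i → s i ≡ false → outside Q (insertᶠ s i) + bit (not (Q i)) ≡ outside Q s
outside-insertᶠ Q s i si = subst (λ b → outside Q (insertᶠ s i) + bit b ≡ outside Q s) (cong (λ b → not b ∧ not (Q i)) si)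
  (countᶠ-add _ _ i (λ j ne → cong (λ b → not b ∧ not (Q j)) (insertᶠ-elsewhere s i j ne)) removed)
  where
  removed : not (insertᶠ s i i) ∧ not (Q i) ≡ false
  removed rewrite ==ᶠ-refl i | ∨-zeroʳ (s i) = refl

pathGame-∪⁅⁆ : ∀ {n} w (Q : Fin n → Bool) S i → pathGame w Q (S ∪ ⁅ i ⁆) ≡ pathGameᶠ w Q (insertᶠ (lookup S) i)
pathGame-∪⁅⁆ w Q S i = pathGameᶠ-cong w Q (lookup-∪⁅⁆ S i)

inside-insert∈Q : ∀ {n} (Q s : Fin n → Bool) i → s i ≡ false → Q i ≡ true → inside Q (insertᶠ s i) ≡ suc (inside Q s)
inside-insert∈Q Q s i si qi = trans (inside-insertᶠ Q s i si) (trans (cong (λ b → inside Q s + bit b) qi) (+-comm _ 1))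

outside-insert∈Q : ∀ {n} (Q s : Fin n → Bool) i → s i ≡ false → Q i ≡ true → outside Q (insertᶠ s i) ≡ outside Q s
outside-insert∈Q Q s i si qi =
  trans (sym (+-identityʳ _)) (trans (cong (λ b → outside Q (insertᶠ s i) + bit (not b)) (sym qi)) (outside-insertᶠ Q s i si))

inside-insert∉Q : ∀ {n} (Q s : Fin n → Bool) i → s i ≡ false → Q i ≡ false → inside Q (insertᶠ s i) ≡ inside Q s
inside-insert∉Q Q s i si qi = trans (inside-insertᶠ Q s i si) (trans (cong (λ b → inside Q s + bit b) qi) (+-identityʳ _))

outside-insert∉Q : ∀ {n} (Q s : Fin n → Bool) i → s i ≡ false → Q i ≡ false → suc (outside Q (insertᶠ s i)) ≡ outside Q s
outside-insert∉Q Q s i si qi =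
  trans (+-comm 1 _) (trans (cong (λ b → outside Q (insertᶠ s i) + bit (not b)) (sym qi)) (outside-insertᶠ Q s i si))

Equivalent-sym : ∀ {n} (v : Game n) i j → Equivalent v i j → Equivalent v j i
Equivalent-sym v i j e S j∉ i∉ = sym (e S i∉ j∉)

Equivalent-cong : ∀ {n} {v v′ : Game n} → (∀ S → v S ≡ v′ S) → ∀ i j → Equivalent v i j → Equivalent v′ i j
Equivalent-cong h i j e S i∉ j∉ = trans (sym (h _)) (trans (e S i∉ j∉) (h _))

sameClass⇒equivalent : ∀ {n} w (Q : Fin n → Bool) i j → Q i ≡ Q j → Equivalent (pathGame w Q) i j
sameClass⇒equivalent w Q i j qi≡qj S i∉ j∉ = begin
  pathGame w Q (S ∪ ⁅ i ⁆)                              ≡⟨ pathGame-∪⁅⁆ w Q S i ⟩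
  win w (inside Q (insertᶠ s i)) (outside Q (insertᶠ s i)) ≡⟨ cong₂ (win w) sameInside sameOutside ⟩
  win w (inside Q (insertᶠ s j)) (outside Q (insertᶠ s j)) ≡⟨ sym (pathGame-∪⁅⁆ w Q S j) ⟩
  pathGame w Q (S ∪ ⁅ j ⁆)                              ∎
  where
  open ≡-Reasoning
  s = lookup S
  si : s i ≡ false
  si = ∉⇒lookup-false {S = S} i∉
  sj : s j ≡ false
  sj = ∉⇒lookup-false {S = S} j∉
  sameInside : inside Q (insertᶠ s i) ≡ inside Q (insertᶠ s j)
  sameInside = trans (inside-insertᶠ Q s i si) (trans (cong (λ b → inside Q s + bit b) qi≡qj) (sym (inside-insertᶠ Q s j sj)))
  sameOutside : outside Q (insertᶠ s i) ≡ outside Q (insertᶠ s j)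
  sameOutside = +-cancelʳ-≡ _ _ _ (trans (outside-insertᶠ Q s i si)
                  (trans (sym (outside-insertᶠ Q s j sj)) (cong (λ b → outside Q (insertᶠ s j) + bit (not b)) (sym qi≡qj))))

-- Adding a player of Q moves a coalition from the cell (x , d) to (x + 1 , d),
-- adding one of ¬ Q moves it to (x , d − 1).
shiftInvariant⇒equivalent : ∀ {n} w (Q : Fin n → Bool) i j → ShiftInvariant w → Fits w Q → Q i ≡ true → Q j ≡ false →
                            Equivalent (pathGame w Q) i j
shiftInvariant⇒equivalent w Q i j si (fitsR , fitsD) qi qj S i∉ j∉ = begin
  pathGame w Q (S ∪ ⁅ i ⁆)                                  ≡⟨ pathGame-∪⁅⁆ w Q S i ⟩
  win w (inside Q (insertᶠ s i)) (outside Q (insertᶠ s i))   ≡⟨ cong₂ (win w) (inside-insert∈Q Q s i sᵢ qi) (outside-insert∈Q Q s i sᵢ qi) ⟩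
  win w (suc (inside Q s)) (outside Q s)                    ≡⟨ cong (win w (suc (inside Q s))) (sym outsideⱼ) ⟩
  win w (suc (inside Q s)) (suc d)                          ≡⟨ si (inside Q s) d x< d< ⟩
  win w (inside Q s) d                                      ≡⟨ cong (λ z → win w z d) (sym (inside-insert∉Q Q s j sⱼ qj)) ⟩
  win w (inside Q (insertᶠ s j)) (outside Q (insertᶠ s j))   ≡⟨ sym (pathGame-∪⁅⁆ w Q S j) ⟩
  pathGame w Q (S ∪ ⁅ j ⁆)                                  ∎
  where
  open ≡-Reasoning
  s = lookup S
  sᵢ : s i ≡ false
  sᵢ = ∉⇒lookup-false {S = S} i∉
  sⱼ : s j ≡ false
  sⱼ = ∉⇒lookup-false {S = S} j∉
  d = outside Q (insertᶠ s j)
  outsideⱼ : suc d ≡ outside Q s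
  outsideⱼ = outside-insert∉Q Q s j sⱼ qj
  x< : suc (inside Q s) < rights w
  x< = subst (suc (inside Q s) <_) (sym fitsR)
         (s≤s (countᶠ-mono-< (λ k → s k ∧ Q k) Q i (λ k → ∧-true₂ {s k}) (cong (_∧ Q i) sᵢ) qi))
  d< : suc d < downs w
  d< = subst (suc d <_) (sym fitsD) (s≤s (subst (_≤ countᶠ (not ∘ Q)) (sym outsideⱼ) (outside≤ Q s)))

-- All but d members of B are taken, leaving d of them outside.
withCounts : ∀ {n} → (Fin n → Bool) → (Fin n → Bool) → ℕ → ℕ → Fin n → Bool
withCounts A B x d = pick x (countᶠ B ∸ d) A B

module _ {n} (Q A B : Fin n → Bool) (A⊆Q : ∀ i → A i ≡ true → Q i ≡ true) (B⊆¬Q : ∀ i → B i ≡ true → not (Q i) ≡ true) where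

  inside-withCounts : ∀ x d → x ≤ countᶠ A → inside Q (withCounts A B x d) ≡ x
  inside-withCounts x d = countᶠ-pick-∧ Q A B A⊆Q B⊆¬Q x (countᶠ B ∸ d)

  outside-withCounts : ∀ x d → d ≤ countᶠ B → outside Q (withCounts A B x d) + countᶠ B ≡ d + countᶠ (not ∘ Q)
  outside-withCounts x d d≤ = begin
    o + countᶠ B              ≡⟨ cong (o +_) (sym (m∸n+n≡m d≤)) ⟩
    o + (countᶠ B ∸ d + d)    ≡⟨ ring o (countᶠ B ∸ d) d ⟩
    d + (countᶠ B ∸ d + o)    ≡⟨ cong (λ z → d + (z + o)) (sym (countᶠ-pick-∧not Q A B A⊆Q B⊆¬Q x _ (m∸n≤m _ d))) ⟩
    d + (countᶠ (λ i → withCounts A B x d i ∧ not (Q i)) + o) ≡⟨ cong (d +_) (present+outside Q _) ⟩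
    d + countᶠ (not ∘ Q)      ∎
    where
    open ≡-Reasoning
    o = outside Q (withCounts A B x d)
    ring : ∀ o e d → o + (e + d) ≡ d + (e + o)
    ring = solve-∀

withCounts-avoids : ∀ {n} (A B : Fin n → Bool) x d i → A i ≡ false → B i ≡ false → withCounts A B x d i ≡ false
withCounts-avoids A B x d = pick-avoids x _ A B

withCounts-mono : ∀ {n} (A B : Fin n → Bool) {x x′ d d′} i → x ≤ x′ → d′ ≤ d →
                  withCounts A B x d i ≡ true → withCounts A B x′ d′ i ≡ true
withCounts-mono A B i x≤ d′≤ = pick-mono _ _ _ _ A B i x≤ (∸-monoʳ-≤ _ d′≤)

cellCoalition : ∀ {n} (Q : Fin n → Bool) x d → x ≤ countᶠ Q → d ≤ countᶠ (not ∘ Q) →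
                inside Q (withCounts Q (not ∘ Q) x d) ≡ x × outside Q (withCounts Q (not ∘ Q) x d) ≡ d
cellCoalition Q x d x≤ d≤ =
  inside-withCounts Q Q (not ∘ Q) (λ _ e → e) (λ _ e → e) x d x≤ ,
  +-cancelʳ-≡ _ _ _ (outside-withCounts Q Q (not ∘ Q) (λ _ e → e) (λ _ e → e) x d d≤)

countᶠ-deleteᶠ-one : ∀ {n} (s : Fin n → Bool) k → s k ≡ true → suc (countᶠ (deleteᶠ s k)) ≡ countᶠ s
countᶠ-deleteᶠ-one s k sk = begin
  suc (countᶠ (deleteᶠ s k))                            ≡⟨ +-comm 1 _ ⟩
  countᶠ (deleteᶠ s k) + 1                              ≡⟨ cong (_+ 1) (countᶠ-cong (λ m → sym (∧-identityʳ (deleteᶠ s k m)))) ⟩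
  countᶠ (λ m → deleteᶠ s k m ∧ true) + bit true        ≡⟨ countᶠ-deleteᶠ s (λ _ → true) k sk ⟩
  countᶠ (λ m → s m ∧ true)                             ≡⟨ countᶠ-cong (λ m → ∧-identityʳ (s m)) ⟩
  countᶠ s                                              ∎
  where open ≡-Reasoning

coalitionAvoiding : ∀ {n} (Q : Fin n → Bool) i j x d → Q i ≡ true → Q j ≡ false → x < countᶠ Q → d < countᶠ (not ∘ Q) →
                    Σ (Fin n → Bool) λ s → s i ≡ false × s j ≡ false × inside Q s ≡ x × outside Q s ≡ suc d
coalitionAvoiding {n} Q i j x d qi qj x< d< = withCounts A B x d , sᵢ , sⱼ , insideₛ , outsideₛ
  where
  A B : Fin n → Bool
  A = deleteᶠ Q i
  B = deleteᶠ (not ∘ Q) j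
  A⊆Q : ∀ k → A k ≡ true → Q k ≡ true
  A⊆Q k = ∧-true₁
  B⊆¬Q : ∀ k → B k ≡ true → not (Q k) ≡ true
  B⊆¬Q k = ∧-true₁
  #A : suc (countᶠ A) ≡ countᶠ Q
  #A = countᶠ-deleteᶠ-one Q i qi
  #B : suc (countᶠ B) ≡ countᶠ (not ∘ Q)
  #B = countᶠ-deleteᶠ-one (not ∘ Q) j (cong not qj)
  sᵢ : withCounts A B x d i ≡ false
  sᵢ = withCounts-avoids A B x d i (trans (cong (λ b → Q i ∧ not b) (==ᶠ-refl i)) (∧-zeroʳ _)) (cong (λ b → not b ∧ not (j ==ᶠ i)) qi)
  sⱼ : withCounts A B x d j ≡ false
  sⱼ = withCounts-avoids A B x d j (cong (_∧ not (i ==ᶠ j)) qj) (trans (cong (λ b → not (Q j) ∧ not b) (==ᶠ-refl j)) (∧-zeroʳ _))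
  insideₛ : inside Q (withCounts A B x d) ≡ x
  insideₛ = inside-withCounts Q A B A⊆Q B⊆¬Q x d (≤-pred (subst (suc x ≤_) (sym #A) x<))
  outsideₛ : outside Q (withCounts A B x d) ≡ suc d
  outsideₛ = +-cancelʳ-≡ (countᶠ B) _ _ (begin
    outside Q (withCounts A B x d) + countᶠ B ≡⟨ outside-withCounts Q A B A⊆Q B⊆¬Q x d (≤-pred (subst (suc d ≤_) (sym #B) d<)) ⟩
    d + countᶠ (not ∘ Q)                      ≡⟨ cong (d +_) (sym #B) ⟩
    d + suc (countᶠ B)                        ≡⟨ +-suc d _ ⟩
    suc d + countᶠ B                          ∎)
    where open ≡-Reasoning

equivalent⇒shiftInvariant : ∀ {n} w (Q : Fin n → Bool) i j → Fits w Q → Q i ≡ true → Q j ≡ false →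
                            Equivalent (pathGame w Q) i j → ShiftInvariant w
equivalent⇒shiftInvariant w Q i j (fitsR , fitsD) qi qj eqv x d x< d<
  with coalitionAvoiding Q i j x d qi qj (≤-pred (subst (suc (suc x) ≤_) fitsR x<)) (≤-pred (subst (suc (suc d) ≤_) fitsD d<))
... | c , cᵢ , cⱼ , insideₛ , outsideₛ = begin
  win w (suc x) (suc d)                                   ≡⟨ cong₂ (win w) (sym insideᵢ) (sym outsideᵢ) ⟩
  win w (inside Q (insertᶠ s i)) (outside Q (insertᶠ s i)) ≡⟨ sym (pathGame-∪⁅⁆ w Q S i) ⟩
  pathGame w Q (S ∪ ⁅ i ⁆)                                ≡⟨ eqv S (lookup-false⇒∉ {S = S} sᵢ) (lookup-false⇒∉ {S = S} sⱼ) ⟩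
  pathGame w Q (S ∪ ⁅ j ⁆)                                ≡⟨ pathGame-∪⁅⁆ w Q S j ⟩
  win w (inside Q (insertᶠ s j)) (outside Q (insertᶠ s j)) ≡⟨ cong₂ (win w) insideⱼ outsideⱼ ⟩
  win w x d                                               ∎
  where
  open ≡-Reasoning
  S = tabulate c
  s = lookup S
  s≗c : ∀ k → s k ≡ c k
  s≗c = lookup∘tabulate c
  sᵢ : s i ≡ false
  sᵢ = trans (s≗c i) cᵢ
  sⱼ : s j ≡ false
  sⱼ = trans (s≗c j) cⱼ
  insideᵢ : inside Q (insertᶠ s i) ≡ suc x
  insideᵢ = trans (inside-insert∈Q Q s i sᵢ qi) (cong suc (trans (inside-cong Q s≗c) insideₛ))
  outsideᵢ : outside Q (insertᶠ s i) ≡ suc d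
  outsideᵢ = trans (outside-insert∈Q Q s i sᵢ qi) (trans (outside-cong Q s≗c) outsideₛ)
  insideⱼ : inside Q (insertᶠ s j) ≡ x
  insideⱼ = trans (inside-insert∉Q Q s j sⱼ qj) (trans (inside-cong Q s≗c) insideₛ)
  outsideⱼ : outside Q (insertᶠ s j) ≡ d
  outsideⱼ = suc-injective (trans (outside-insert∉Q Q s j sⱼ qj) (trans (outside-cong Q s≗c) outsideₛ))

allWin⇒shiftInvariant : ∀ w → win w 0 (pred (downs w)) ≡ true → ShiftInvariant w
allWin⇒shiftInvariant w e x d _ q = trans (allWin (suc d) q) (sym (allWin d (<⇒≤ q)))
  where
  allWin : ∀ {x} d → d < downs w → win w x d ≡ true
  allWin d d< = win-mono w z≤n (<⇒≤pred d<) e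

allLose⇒shiftInvariant : ∀ w → win w (pred (rights w)) 0 ≡ false → ShiftInvariant w
allLose⇒shiftInvariant w e x d p _ = trans (allLose (suc x) p) (sym (allLose x (<⇒≤ p)))
  where
  allLose : ∀ {d} x → x < rights w → win w x d ≡ false
  allLose {d} x x< with win w x d in e′
  ... | false = refl
  ... | true  = ⊥-elim (true≢false (trans (sym (win-mono w (<⇒≤pred x<) z≤n e′)) e))

rights≤1⇒shiftInvariant : ∀ w → rights w ≤ 1 → ShiftInvariant w
rights≤1⇒shiftInvariant w r≤1 x d p _ = ⊥-elim (<⇒≱ p (≤-trans r≤1 (s≤s z≤n)))

downs≤1⇒shiftInvariant : ∀ w → downs w ≤ 1 → ShiftInvariant w
downs≤1⇒shiftInvariant w d≤1 x d _ q = ⊥-elim (<⇒≱ q (≤-trans d≤1 (s≤s z≤n)))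

¬shiftInvariant⇒2≤rights : ∀ w → ¬ ShiftInvariant w → 2 ≤ rights w
¬shiftInvariant⇒2≤rights w ¬si with 2 ≤? rights w
... | yes p = p
... | no ¬p = ⊥-elim (¬si (rights≤1⇒shiftInvariant w (≤-pred (≰⇒> ¬p))))

¬shiftInvariant⇒2≤downs : ∀ w → ¬ ShiftInvariant w → 2 ≤ downs w
¬shiftInvariant⇒2≤downs w ¬si with 2 ≤? downs w
... | yes p = p
... | no ¬p = ⊥-elim (¬si (downs≤1⇒shiftInvariant w (≤-pred (≰⇒> ¬p))))

pathGame-monotone : ∀ {n} w (Q : Fin n → Bool) S T → S ⊆ T → pathGame w Q S ≡ true → pathGame w Q T ≡ true
pathGame-monotone w Q S T S⊆T = win-mono w (countᶠ-mono _ _ moreInside) (countᶠ-mono _ _ fewerOutside)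
  where
  ⊆⇒ : ∀ i → lookup S i ≡ true → lookup T i ≡ true
  ⊆⇒ i e = []=⇒lookup (S⊆T (lookup⇒[]= i S e))
  moreInside : ∀ i → lookup S i ∧ Q i ≡ true → lookup T i ∧ Q i ≡ true
  moreInside i e rewrite ⊆⇒ i (∧-true₁ e) = ∧-true₂ {lookup S i} e
  fewerOutside : ∀ i → not (lookup T i) ∧ not (Q i) ≡ true → not (lookup S i) ∧ not (Q i) ≡ true
  fewerOutside i e with lookup T i in eT
  ... | false rewrite ⊆-contra ⊆⇒ i eT = e
  ... | true  = ⊥-elim (true≢false (sym e))

pathGame-isSimpleGame : ∀ {n} w (Q : Fin n → Bool) → Fits w Q → ¬ ShiftInvariant w → IsSimpleGame (pathGame w Q)
pathGame-isSimpleGame {n} w Q (fitsR , fitsD) ¬si = record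
  { empty-lose = trans (cong₂ (win w) (trans (inside-cong Q (λ k → lookup-replicate k false)) (countᶠ-false {n}))
                                      (outside-cong Q (λ k → lookup-replicate k false)))
                       emptyLoses
  ; grand-win  = trans (cong₂ (win w) (inside-cong Q (λ k → lookup-replicate k true))
                                      (trans (outside-cong Q (λ k → lookup-replicate k true)) (countᶠ-false {n})))
                       grandWins
  ; monotone   = λ S T S⊆T → ≤ᴮ-from (pathGame-monotone w Q S T S⊆T) }
  where
  emptyLoses : win w 0 (countᶠ (not ∘ Q)) ≡ false
  emptyLoses with win w 0 (countᶠ (not ∘ Q)) in e
  ... | false = refl
  ... | true  = ⊥-elim (¬si (allWin⇒shiftInvariant w (trans (cong (win w 0 ∘ pred) fitsD) e)))
  grandWins : win w (countᶠ Q) 0 ≡ true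
  grandWins with win w (countᶠ Q) 0 in e
  ... | true  = refl
  ... | false = ⊥-elim (¬si (allLose⇒shiftInvariant w (trans (cong (λ r → win w (pred r) 0) fitsR) e)))
  ≤ᴮ-from : ∀ {a b} → (a ≡ true → b ≡ true) → a ≤ᴮ b
  ≤ᴮ-from {false} {false} _ = b≤b
  ≤ᴮ-from {false} {true}  _ = f≤t
  ≤ᴮ-from {true}  h rewrite h refl = b≤b

equivalent⇒sameClass : ∀ {n} w (Q : Fin n → Bool) a b → Fits w Q → ¬ ShiftInvariant w → Equivalent (pathGame w Q) a b → Q a ≡ Q b
equivalent⇒sameClass w Q a b fits ¬si e with Q a in qa | Q b in qb
... | true  | true  = refl
... | false | false = refl
... | true  | false = ⊥-elim (¬si (equivalent⇒shiftInvariant w Q a b fits qa qb e))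
... | false | true  = ⊥-elim (¬si (equivalent⇒shiftInvariant w Q b a fits qb qa (Equivalent-sym (pathGame w Q) a b e)))

pathGame-hasTwoClasses : ∀ {n} w (Q : Fin n → Bool) → Fits w Q → ¬ ShiftInvariant w → HasExactlyTwoClasses (pathGame w Q)
pathGame-hasTwoClasses w Q (fitsR , fitsD) ¬si with
  countᶠ>0⇒witness Q (≤-pred (subst (2 ≤_) fitsR (¬shiftInvariant⇒2≤rights w ¬si))) |
  countᶠ>0⇒witness (not ∘ Q) (≤-pred (subst (2 ≤_) fitsD (¬shiftInvariant⇒2≤downs w ¬si)))
... | i , qi | j , ¬qj = i , j , notEquivalent , classify
  where
  qj : Q j ≡ false
  qj = trans (sym (not-involutive (Q j))) (cong not ¬qj)
  notEquivalent : ¬ Equivalent (pathGame w Q) i j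
  notEquivalent = ¬si ∘ equivalent⇒shiftInvariant w Q i j (fitsR , fitsD) qi qj
  classify : ∀ k → Equivalent (pathGame w Q) k i ⊎ Equivalent (pathGame w Q) k j
  classify k with Q k in qk
  ... | true  = inj₁ (sameClass⇒equivalent w Q k i (trans qk (sym qi)))
  ... | false = inj₂ (sameClass⇒equivalent w Q k j (trans qk (sym qj)))

Fits-dual : ∀ {n} w (Q : Fin n → Bool) → Fits w Q → Fits (dual w) (not ∘ Q)
Fits-dual w Q (fitsR , fitsD) =
  trans (rights-dual w) fitsD , trans (downs-dual w) (trans fitsR (cong suc (countᶠ-cong (λ i → sym (not-involutive (Q i))))))

pathGame-dual : ∀ {n} w (Q : Fin n → Bool) → Fits w Q → ∀ S → pathGame w Q S ≡ pathGame (dual w) (not ∘ Q) S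
pathGame-dual w Q (fitsR , fitsD) S = sym (begin
  win (dual w) present (outside (not ∘ Q) s) ≡⟨ cong (win (dual w) present) (countᶠ-cong (λ i → cong (not (s i) ∧_) (not-involutive (Q i)))) ⟩
  win (dual w) present missing              ≡⟨ win-dual w present missing present< missing< ⟩
  win w (rights w ∸ suc missing) (downs w ∸ suc present) ≡⟨ cong₂ (λ a b → win w (a ∸ suc missing) (b ∸ suc present)) fitsR fitsD ⟩
  win w (countᶠ Q ∸ missing) (countᶠ (not ∘ Q) ∸ present) ≡⟨ cong₂ (win w) (trans (cong (_∸ missing) (sym #Q)) (m+n∸n≡m (inside Q s) missing))
                                                                        (trans (cong (_∸ present) (sym #¬Q)) (m+n∸m≡n present (outside Q s))) ⟩
  win w (inside Q s) (outside Q s)          ∎)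
  where
  open ≡-Reasoning
  s = lookup S
  present = countᶠ (λ i → s i ∧ not (Q i))
  missing = countᶠ (λ i → not (s i) ∧ Q i)
  #¬Q : present + outside Q s ≡ countᶠ (not ∘ Q)
  #¬Q = present+outside Q s
  #Q : inside Q s + missing ≡ countᶠ Q
  #Q = inside+missing Q s
  present< : present < downs (w)
  present< = subst (present <_) (sym fitsD) (s≤s (subst (present ≤_) #¬Q (m≤m+n present _)))
  missing< : missing < rights w
  missing< = subst (missing <_) (sym fitsR) (s≤s (subst (missing ≤_) #Q (m≤n+m missing _)))

pathGame-image : ∀ {n} (σ : Permutation′ n) w (Q Q′ : Fin n → Bool) → (∀ i → Q′ (σ ⟨$⟩ʳ i) ≡ Q i) →
                 ∀ S → pathGame w Q′ (image σ S) ≡ pathGame w Q S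
pathGame-image σ w Q Q′ h S = cong₂ (win w) sameInside sameOutside
  where
  lookup-image : ∀ j → lookup (image σ S) j ≡ lookup S (σ ⟨$⟩ˡ j)
  lookup-image = lookup∘tabulate (λ j → lookup S (σ ⟨$⟩ˡ j))
  sameInside : inside Q′ (lookup (image σ S)) ≡ inside Q (lookup S)
  sameInside = trans (inside-cong Q′ lookup-image) (trans (sym (countᶠ-permute σ (λ j → lookup S (σ ⟨$⟩ˡ j) ∧ Q′ j)))
                 (countᶠ-cong (λ i → cong₂ _∧_ (cong (lookup S) (inverseˡ σ)) (h i))))
  sameOutside : outside Q′ (lookup (image σ S)) ≡ outside Q (lookup S)
  sameOutside = trans (outside-cong Q′ lookup-image) (trans (sym (countᶠ-permute σ (λ j → not (lookup S (σ ⟨$⟩ˡ j)) ∧ not (Q′ j))))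
                  (countᶠ-cong (λ i → cong₂ (λ a b → not a ∧ not b) (cong (lookup S) (inverseˡ σ)) (h i))))

punchIn-<ᵇ : ∀ {m} (j : Fin (suc m)) (y : Fin m) → (toℕ (punchIn j y) <ᵇ toℕ j) ≡ (toℕ y <ᵇ toℕ j)
punchIn-<ᵇ zero    y       = refl
punchIn-<ᵇ (suc j) zero    = refl
punchIn-<ᵇ (suc j) (suc y) = punchIn-<ᵇ j y

toFront : ∀ {n} (Q : Fin n → Bool) → Σ (Permutation′ n) λ σ → ∀ i → (toℕ (σ ⟨$⟩ʳ i) <ᵇ countᶠ Q) ≡ Q i
toFront {zero}  Q = id , λ ()
toFront {suc n} Q with toFront (Q ∘ suc) | Q zero in q₀
... | σ , h | true  = lift₀ σ , front
  where
  front : ∀ i → (toℕ (lift₀ σ ⟨$⟩ʳ i) <ᵇ suc (countᶠ (Q ∘ suc))) ≡ Q i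
  front zero    rewrite q₀ = refl
  front (suc i) = h i
... | σ , h | false = insert zero j σ , front
  where
  j : Fin (suc n)
  j = fromℕ< (s≤s (countᶠ≤ (Q ∘ suc)))
  toℕj : toℕ j ≡ countᶠ (Q ∘ suc)
  toℕj = toℕ-fromℕ< (s≤s (countᶠ≤ (Q ∘ suc)))
  front : ∀ i → (toℕ (insert zero j σ ⟨$⟩ʳ i) <ᵇ countᶠ (Q ∘ suc)) ≡ Q i
  front zero    rewrite q₀ | toℕj = <ᵇ-false {countᶠ (Q ∘ suc)} ≤-refl
  front (suc i) = begin
    (toℕ (punchIn j (σ ⟨$⟩ʳ i)) <ᵇ countᶠ (Q ∘ suc)) ≡⟨ cong (toℕ (punchIn j (σ ⟨$⟩ʳ i)) <ᵇ_) (sym toℕj) ⟩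
    (toℕ (punchIn j (σ ⟨$⟩ʳ i)) <ᵇ toℕ j)            ≡⟨ punchIn-<ᵇ j (σ ⟨$⟩ʳ i) ⟩
    (toℕ (σ ⟨$⟩ʳ i) <ᵇ toℕ j)                        ≡⟨ cong (toℕ (σ ⟨$⟩ʳ i) <ᵇ_) toℕj ⟩
    (toℕ (σ ⟨$⟩ʳ i) <ᵇ countᶠ (Q ∘ suc))             ≡⟨ h i ⟩
    Q (suc i)                                        ∎
    where open ≡-Reasoning

-- Rigidity

pathGame-injective : ∀ {n} u u′ (Q : Fin n → Bool) → Fits u Q → Fits u′ Q →
                     (∀ S → pathGame u Q S ≡ pathGame u′ Q S) → u ≡ u′
pathGame-injective u u′ Q (fitsR , fitsD) (fitsR′ , fitsD′) same =
  win-injective u u′ (trans fitsR (sym fitsR′)) (trans fitsD (sym fitsD′)) sameCells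
  where
  sameCells : ∀ x d → x < rights u → d < downs u → win u x d ≡ win u′ x d
  sameCells x d x< d< = begin
    win u x d       ≡⟨ sym (cong₂ (win u) insideS outsideS) ⟩
    pathGame u Q S  ≡⟨ same S ⟩
    pathGame u′ Q S ≡⟨ cong₂ (win u′) insideS outsideS ⟩
    win u′ x d      ∎
    where
    open ≡-Reasoning
    S = tabulate (withCounts Q (not ∘ Q) x d)
    cell : inside Q (withCounts Q (not ∘ Q) x d) ≡ x × outside Q (withCounts Q (not ∘ Q) x d) ≡ d
    cell = cellCoalition Q x d (≤-pred (subst (suc x ≤_) fitsR x<)) (≤-pred (subst (suc d ≤_) fitsD d<))
    insideS : inside Q (lookup S) ≡ x
    insideS = trans (inside-cong Q (lookup∘tabulate _)) (proj₁ cell)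
    outsideS : outside Q (lookup S) ≡ d
    outsideS = trans (outside-cong Q (lookup∘tabulate _)) (proj₂ cell)

==-iff : ∀ {a b d} → (a ≡ true → b ≡ d) → (b ≡ d → a ≡ true) → (d == b) ≡ a
==-iff {true}  {b} {d} f _ rewrite f refl = ==-refl d
==-iff {false} {b} {d} _ g with b Bool.≟ d
... | yes b≡d = ⊥-elim (true≢false (sym (g b≡d)))
... | no  b≢d with b | d
...   | true  | true  = ⊥-elim (b≢d refl)
...   | false | false = ⊥-elim (b≢d refl)
...   | true  | false = refl
...   | false | true  = refl

-- The equivalence classes are determined by the game, up to swapping them.
equalPathGames⇒sameClasses : ∀ {n} u u′ (Q₁ Q₂ : Fin n → Bool) → Fits u Q₁ → Fits u′ Q₂ → ¬ ShiftInvariant u → ¬ ShiftInvariant u′ →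
                             (∀ S → pathGame u Q₁ S ≡ pathGame u′ Q₂ S) → Σ (Fin n) λ i₀ → ∀ j → (Q₂ i₀ == Q₂ j) ≡ Q₁ j
equalPathGames⇒sameClasses u u′ Q₁ Q₂ F₁ F₂ ¬si ¬si′ same
  with countᶠ>0⇒witness Q₁ (≤-pred (subst (2 ≤_) (proj₁ F₁) (¬shiftInvariant⇒2≤rights u ¬si)))
... | i₀ , q₁ = i₀ , λ j → ==-iff (to j) (from j)
  where
  to : ∀ j → Q₁ j ≡ true → Q₂ j ≡ Q₂ i₀
  to j e = equivalent⇒sameClass u′ Q₂ j i₀ F₂ ¬si′
             (Equivalent-cong same j i₀ (sameClass⇒equivalent u Q₁ j i₀ (trans e (sym q₁))))
  from : ∀ j → Q₂ j ≡ Q₂ i₀ → Q₁ j ≡ true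
  from j e = trans (equivalent⇒sameClass u Q₁ j i₀ F₁ ¬si
                      (Equivalent-cong (sym ∘ same) j i₀ (sameClass⇒equivalent u′ Q₂ j i₀ e))) q₁

canonicalᵇ-intro : ∀ w → ¬ ShiftInvariant w → (w ≤ˡᵉˣ dual w) ≡ true → canonicalᵇ w ≡ true
canonicalᵇ-intro w ¬si ≤dual with shiftInvariantᵇ w in e
... | true  = ⊥-elim (¬si (shiftInvariantᵇ-sound w e))
... | false = ≤dual

canonical⇒¬shiftInvariant : ∀ w → canonicalᵇ w ≡ true → ¬ ShiftInvariant w
canonical⇒¬shiftInvariant w c = shiftInvariantᵇ-false w (Bool.not-injective (∧-true₁ c))

canonical⇒≤ˡᵉˣ-dual : ∀ w → canonicalᵇ w ≡ true → (w ≤ˡᵉˣ dual w) ≡ true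
canonical⇒≤ˡᵉˣ-dual w = ∧-true₂ {not (shiftInvariantᵇ w)}

Fits-congᶜ : ∀ {n} w {Q Q′ : Fin n → Bool} → (∀ i → Q i ≡ Q′ i) → Fits w Q → Fits w Q′
Fits-congᶜ w h (fitsR , fitsD) = trans fitsR (cong suc (countᶠ-cong h)) , trans fitsD (cong suc (countᶠ-cong (cong not ∘ h)))

rigidity : ∀ {n} u u′ (Q₁ Q₂ : Fin n → Bool) → Fits u Q₁ → Fits u′ Q₂ → canonicalᵇ u ≡ true → canonicalᵇ u′ ≡ true →
           (∀ S → pathGame u Q₁ S ≡ pathGame u′ Q₂ S) → u ≡ u′
rigidity u u′ Q₁ Q₂ F₁ F₂ c c′ same
  with equalPathGames⇒sameClasses u u′ Q₁ Q₂ F₁ F₂ (canonical⇒¬shiftInvariant u c) (canonical⇒¬shiftInvariant u′ c′) same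
... | i₀ , classes with Q₂ i₀
...   | true  = pathGame-injective u u′ Q₁ F₁ (Fits-congᶜ u′ classes F₂)
                  (λ S → trans (same S) (pathGame-congᶜ u′ classes S))
...   | false = ≤ˡᵉˣ-antisym u u′
                  (trans (cong (u ≤ˡᵉˣ_) (sym (trans (cong dual u≡) (dual-involutive u′)))) (canonical⇒≤ˡᵉˣ-dual u c))
                  (trans (cong (u′ ≤ˡᵉˣ_) u≡) (canonical⇒≤ˡᵉˣ-dual u′ c′))
  where
  u≡ : u ≡ dual u′
  u≡ = pathGame-injective u (dual u′) Q₁ F₁ (Fits-congᶜ (dual u′) classes (Fits-dual u′ Q₂ F₂))
         (λ S → trans (same S) (trans (pathGame-dual u′ Q₂ F₂ S) (pathGame-congᶜ (dual u′) classes S)))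

module _ {n} (v : Game n) where

  vᶠ : (Fin n → Bool) → Bool
  vᶠ s = v (tabulate s)

  vᶠ-cong : ∀ {s t : Fin n → Bool} → (∀ k → s k ≡ t k) → vᶠ s ≡ vᶠ t
  vᶠ-cong h = cong v (tabulate-cong h)

  Equivalentᶠ : Fin n → Fin n → Set
  Equivalentᶠ a b = ∀ s → s a ≡ false → s b ≡ false → vᶠ (insertᶠ s a) ≡ vᶠ (insertᶠ s b)

  tabulate-insertᶠ : ∀ (s : Fin n → Bool) a → tabulate s ∪ ⁅ a ⁆ ≡ tabulate (insertᶠ s a)
  tabulate-insertᶠ s a = trans (sym (tabulate∘lookup (tabulate s ∪ ⁅ a ⁆)))
    (tabulate-cong (λ k → trans (lookup-∪⁅⁆ (tabulate s) a k) (cong (_∨ (a ==ᶠ k)) (lookup∘tabulate s k))))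

  Equivalent⇒Equivalentᶠ : ∀ a b → Equivalent v a b → Equivalentᶠ a b
  Equivalent⇒Equivalentᶠ a b e s sa sb = begin
    v (tabulate (insertᶠ s a)) ≡⟨ cong v (sym (tabulate-insertᶠ s a)) ⟩
    v (tabulate s ∪ ⁅ a ⁆)    ≡⟨ e (tabulate s) (lookup-false⇒∉ {S = tabulate s} (trans (lookup∘tabulate s a) sa))
                                                (lookup-false⇒∉ {S = tabulate s} (trans (lookup∘tabulate s b) sb)) ⟩
    v (tabulate s ∪ ⁅ b ⁆)    ≡⟨ cong v (tabulate-insertᶠ s b) ⟩
    v (tabulate (insertᶠ s b)) ∎
    where open ≡-Reasoning

  Equivalentᶠ-sym : ∀ a b → Equivalentᶠ a b → Equivalentᶠ b a
  Equivalentᶠ-sym a b e s sb sa = sym (e s sa sb)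

  -- If b ∈ s, compare s + a and s + c through s − b + a + c.
  Equivalentᶠ-trans : ∀ a b c → Equivalentᶠ a b → Equivalentᶠ b c → Equivalentᶠ a c
  Equivalentᶠ-trans a b c ab bc s sa sc with a Fin.≟ c
  ... | yes refl = refl
  ... | no a≢c with s b in sb
  ...   | false = trans (ab s sa sb) (bc s sb sc)
  ...   | true  = begin
    vᶠ (insertᶠ s a)                     ≡⟨ vᶠ-cong (reinsert a) ⟩
    vᶠ (insertᶠ (insertᶠ t a) b)         ≡⟨ bc (insertᶠ t a) (absent a b a≢b tb) (absent a c a≢c tc) ⟩
    vᶠ (insertᶠ (insertᶠ t a) c)         ≡⟨ vᶠ-cong (λ k → ∨-swap (t k) (a ==ᶠ k) (c ==ᶠ k)) ⟩
    vᶠ (insertᶠ (insertᶠ t c) a)         ≡⟨ ab (insertᶠ t c) (absent c a (a≢c ∘ sym) ta) (absent c b c≢b tb) ⟩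
    vᶠ (insertᶠ (insertᶠ t c) b)         ≡⟨ sym (vᶠ-cong (reinsert c)) ⟩
    vᶠ (insertᶠ s c)                     ∎
    where
    open ≡-Reasoning
    t = deleteᶠ s b
    a≢b : a ≢ b
    a≢b refl = true≢false (trans (sym sb) sa)
    c≢b : c ≢ b
    c≢b refl = true≢false (trans (sym sb) sc)
    ∨-swap : ∀ x y z → (x ∨ y) ∨ z ≡ (x ∨ z) ∨ y
    ∨-swap true  y     z     = refl
    ∨-swap false true  true  = refl
    ∨-swap false true  false = refl
    ∨-swap false false z     = sym (∨-identityʳ z)
    reinsert : ∀ x k → insertᶠ s x k ≡ insertᶠ (insertᶠ t x) b k
    reinsert x k with b ==ᶠ k in e
    ... | true rewrite sym (==ᶠ⇒≡ b k e) | sb = sym (∨-zeroʳ _)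
    ... | false = sym (trans (∨-identityʳ _) (cong (_∨ (x ==ᶠ k)) (∧-identityʳ (s k))))
    ta : t a ≡ false
    ta = cong (_∧ not (b ==ᶠ a)) sa
    tb : t b ≡ false
    tb = trans (cong (λ z → s b ∧ not z) (==ᶠ-refl b)) (∧-zeroʳ (s b))
    tc : t c ≡ false
    tc = cong (_∧ not (b ==ᶠ c)) sc
    absent : ∀ x y → x ≢ y → t y ≡ false → insertᶠ t x y ≡ false
    absent x y x≢y ty = cong₂ _∨_ ty (≢⇒==ᶠ-false x y x≢y)

countᶠ-exchange : ∀ {n} (s R : Fin n → Bool) k l → s k ≡ true → s l ≡ false → R k ≡ R l →
                  countᶠ (λ m → insertᶠ (deleteᶠ s k) l m ∧ R m) ≡ countᶠ (λ m → s m ∧ R m)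
countᶠ-exchange s R k l sk sl rk≡rl = begin
  countᶠ (λ m → insertᶠ (deleteᶠ s k) l m ∧ R m) ≡⟨ sym (countᶠ-insertᶠ (deleteᶠ s k) R l (cong (_∧ not (k ==ᶠ l)) sl)) ⟩
  countᶠ (λ m → deleteᶠ s k m ∧ R m) + bit (R l) ≡⟨ cong (λ b → countᶠ (λ m → deleteᶠ s k m ∧ R m) + bit b) (sym rk≡rl) ⟩
  countᶠ (λ m → deleteᶠ s k m ∧ R m) + bit (R k) ≡⟨ countᶠ-deleteᶠ s R k sk ⟩
  countᶠ (λ m → s m ∧ R m)                       ∎
  where open ≡-Reasoning

module _ {n} (P : Fin n → Bool) where

  SameCounts : (Fin n → Bool) → (Fin n → Bool) → Set
  SameCounts s t = ∀ c → countᶠ (λ m → s m ∧ (P m == c)) ≡ countᶠ (λ m → t m ∧ (P m == c))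

  sameCounts⇒≡ : ∀ s t → countᶠ (λ m → s m ∧ not (t m)) ≡ 0 → SameCounts s t → ∀ m → s m ≡ t m
  sameCounts⇒≡ s t s⊆t same m with s m in sm | t m in tm
  ... | true  | true  = refl
  ... | false | false = refl
  ... | true  | false = ⊥-elim (true≢false (trans (sym (cong₂ _∧_ sm (cong not tm))) (countᶠ≡0⇒false _ s⊆t m)))
  ... | false | true  = ⊥-elim (<-irrefl (same (P m))
    (countᶠ-mono-< (λ q → s q ∧ (P q == P m)) (λ q → t q ∧ (P q == P m)) m grow
       (cong (_∧ (P m == P m)) sm) (trans (cong (_∧ (P m == P m)) tm) (==-refl (P m)))))
    where
    grow : ∀ q → s q ∧ (P q == P m) ≡ true → t q ∧ (P q == P m) ≡ true
    grow q e with s q in sq | t q in tq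
    ... | true | true  = e
    ... | true | false = ⊥-elim (true≢false (trans (sym (cong₂ _∧_ sq (cong not tq))) (countᶠ≡0⇒false _ s⊆t q)))

  partners : (Fin n → Bool) → (Fin n → Bool) → Fin n → Fin n → Bool
  partners s t k m = t m ∧ (not (s m) ∧ (P m == P k))

  partners-nonempty : ∀ s t k → SameCounts s t → s k ≡ true → t k ≡ false → 0 < countᶠ (partners s t k)
  partners-nonempty s t k same sk tk with countᶠ (partners s t k) in #p
  ... | suc _ = s≤s z≤n
  ... | zero  = ⊥-elim (<-irrefl (sym (same (P k)))
    (countᶠ-mono-< (λ q → t q ∧ (P q == P k)) (λ q → s q ∧ (P q == P k)) k shrink
       (cong (_∧ (P k == P k)) tk) (trans (cong (_∧ (P k == P k)) sk) (==-refl (P k)))))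
    where
    shrink : ∀ q → t q ∧ (P q == P k) ≡ true → s q ∧ (P q == P k) ≡ true
    shrink q e with s q in sq
    ... | true  = ∧-true₂ {t q} e
    ... | false = ⊥-elim (true≢false (trans (sym e) (trans (cong (λ b → t q ∧ (not b ∧ (P q == P k))) (sym sq))
                                                           (countᶠ≡0⇒false (partners s t k) #p q))))

  exchangePartner : ∀ s t k → SameCounts s t → s k ≡ true → t k ≡ false →
                    Σ (Fin n) λ l → t l ≡ true × s l ≡ false × P l ≡ P k
  exchangePartner s t k same sk tk with countᶠ>0⇒witness (partners s t k) (partners-nonempty s t k same sk tk)
  ... | l , pl = l , ∧-true₁ pl , Bool.not-injective (∧-true₁ (∧-true₂ {t l} pl)) ,
                 ==⇒≡ (P l) (P k) (∧-true₂ {not (s l)} (∧-true₂ {t l} pl))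

-- A game in which players of the same class (given by P) are equivalent only
-- depends on how many players of each class a coalition contains: exchange the
-- players of s ∖ t one by one for players of t ∖ s of the same class.
module _ {n} (v : Game n) (P : Fin n → Bool) (classEquivalent : ∀ k l → P k ≡ P l → Equivalentᶠ v k l) where

  sameCounts⇒sameValue : ∀ μ s t → countᶠ (λ m → s m ∧ not (t m)) ≡ μ → SameCounts P s t → vᶠ v s ≡ vᶠ v t
  sameCounts⇒sameValue zero    s t #s∖t same = vᶠ-cong v (sameCounts⇒≡ P s t #s∖t same)
  sameCounts⇒sameValue (suc μ) s t #s∖t same
    with countᶠ>0⇒witness (λ m → s m ∧ not (t m)) (subst (0 <_) (sym #s∖t) (s≤s z≤n))
  ... | k , k∈s∖t with exchangePartner P s t k same (∧-true₁ k∈s∖t) (Bool.not-injective (∧-true₂ {s k} k∈s∖t))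
  ...   | l , tl , sl , pl≡pk = begin
    vᶠ v s                  ≡⟨ vᶠ-cong v restore ⟩
    vᶠ v (insertᶠ s′ k)      ≡⟨ classEquivalent k l (sym pl≡pk) s′ s′k s′l ⟩
    vᶠ v (insertᶠ s′ l)      ≡⟨ sameCounts⇒sameValue μ (insertᶠ s′ l) t #exchanged
                                 (λ c → trans (countᶠ-exchange s (λ m → P m == c) k l sk sl (cong (_== c) (sym pl≡pk))) (same c)) ⟩
    vᶠ v t                  ∎
    where
    open ≡-Reasoning
    s′ = deleteᶠ s k
    sk : s k ≡ true
    sk = ∧-true₁ k∈s∖t
    tk : t k ≡ false
    tk = Bool.not-injective (∧-true₂ {s k} k∈s∖t)
    s′k : s′ k ≡ false
    s′k = trans (cong (λ b → s k ∧ not b) (==ᶠ-refl k)) (∧-zeroʳ (s k))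
    s′l : s′ l ≡ false
    s′l = cong (_∧ not (k ==ᶠ l)) sl
    restore : ∀ m → s m ≡ insertᶠ s′ k m
    restore m with k ==ᶠ m in e
    ... | true rewrite sym (==ᶠ⇒≡ k m e) | sk = refl
    ... | false = sym (trans (∨-identityʳ _) (∧-identityʳ (s m)))
    #exchanged : countᶠ (λ m → insertᶠ s′ l m ∧ not (t m)) ≡ μ
    #exchanged = suc-injective (begin
      suc (countᶠ (λ m → insertᶠ s′ l m ∧ not (t m)))            ≡⟨ cong suc (sym (countᶠ-insertᶠ s′ (not ∘ t) l s′l)) ⟩
      suc (countᶠ (λ m → s′ m ∧ not (t m)) + bit (not (t l)))   ≡⟨ cong (λ b → suc (countᶠ (λ m → s′ m ∧ not (t m)) + bit (not b))) tl ⟩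
      suc (countᶠ (λ m → s′ m ∧ not (t m)) + 0)                 ≡⟨ cong suc (+-identityʳ _) ⟩
      suc (countᶠ (λ m → s′ m ∧ not (t m)))                     ≡⟨ sym (trans (cong (λ b → countᶠ (λ m → s′ m ∧ not (t m)) + bit (not b)) tk)
                                                                          (+-comm _ 1)) ⟩
      countᶠ (λ m → s′ m ∧ not (t m)) + bit (not (t k))         ≡⟨ countᶠ-deleteᶠ s (not ∘ t) k sk ⟩
      countᶠ (λ m → s m ∧ not (t m))                            ≡⟨ #s∖t ⟩
      suc μ                                                     ∎)

-- Completeness

module _ {n} (v : Game n) (simple : IsSimpleGame v) (i j : Fin n) (i≁j : ¬ Equivalent v i j)
         (classes : ∀ k → Equivalent v k i ⊎ Equivalent v k j) where

  classOf : Fin n → Bool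
  classOf k with classes k
  ... | inj₁ _ = true
  ... | inj₂ _ = false

  classOf-equivalent : ∀ k l → classOf k ≡ classOf l → Equivalentᶠ v k l
  classOf-equivalent k l e with classes k | classes l
  classOf-equivalent k l _  | inj₁ k∼i | inj₁ l∼i =
    Equivalentᶠ-trans v k i l (Equivalent⇒Equivalentᶠ v k i k∼i) (Equivalentᶠ-sym v l i (Equivalent⇒Equivalentᶠ v l i l∼i))
  classOf-equivalent k l _  | inj₂ k∼j | inj₂ l∼j =
    Equivalentᶠ-trans v k j l (Equivalent⇒Equivalentᶠ v k j k∼j) (Equivalentᶠ-sym v l j (Equivalent⇒Equivalentᶠ v l j l∼j))
  classOf-equivalent k l () | inj₁ _   | inj₂ _
  classOf-equivalent k l () | inj₂ _   | inj₁ _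

  classOf-i : classOf i ≡ true
  classOf-i with classes i
  ... | inj₁ _   = refl
  ... | inj₂ i∼j = ⊥-elim (i≁j i∼j)

  classOf-j : classOf j ≡ false
  classOf-j with classes j
  ... | inj₂ _   = refl
  ... | inj₁ j∼i = ⊥-elim (i≁j (Equivalent-sym v j i j∼i))

  vᶠ-monotone : ∀ (s t : Fin n → Bool) → (∀ k → s k ≡ true → t k ≡ true) → vᶠ v s ≡ true → vᶠ v t ≡ true
  vᶠ-monotone s t s⊆t e = true≤ (subst (_≤ᴮ vᶠ v t) e (IsSimpleGame.monotone simple (tabulate s) (tabulate t) tab⊆))
    where
    true≤ : ∀ {b} → true ≤ᴮ b → b ≡ true
    true≤ b≤b = refl
    tab⊆ : tabulate s ⊆ tabulate t
    tab⊆ {k} k∈ = lookup⇒[]= k (tabulate t) (trans (lookup∘tabulate t k) (s⊆t k (trans (sym (lookup∘tabulate s k)) ([]=⇒lookup k∈))))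

  cellValue : ℕ → ℕ → Bool
  cellValue x d = vᶠ v (withCounts classOf (not ∘ classOf) x d)

  cellValue-monotoneOn : ∀ r s → MonotoneOn r s cellValue
  cellValue-monotoneOn r s = record
    { sucˣ  = λ x d _ _ → vᶠ-monotone _ _ (λ k → withCounts-mono classOf (not ∘ classOf) {d = d} k (n≤1+n x) ≤-refl)
    ; predᵈ = λ x d _ _ → vᶠ-monotone _ _ (λ k → withCounts-mono classOf (not ∘ classOf) {x = x} k ≤-refl (n≤1+n d)) }

  gamePath : Word
  gamePath = encode (suc (countᶠ classOf)) (suc (countᶠ (not ∘ classOf))) cellValue

  gamePath-fits : Fits gamePath classOf
  gamePath-fits = rights-encode (suc (countᶠ classOf)) (suc (countᶠ (not ∘ classOf))) cellValue ,
                  downs-encode (suc (countᶠ classOf)) (suc (countᶠ (not ∘ classOf))) cellValue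

  -- The value of a coalition only depends on its cell, where gamePath records it.
  game≡pathGame : ∀ S → v S ≡ pathGame gamePath classOf S
  game≡pathGame S = sym (begin
    win gamePath x d                                  ≡⟨ win-encode (suc α) (suc β) cellValue (cellValue-monotoneOn _ _) x d
                                                           (s≤s (inside≤ classOf s)) (s≤s (outside≤ classOf s)) ⟩
    vᶠ v (withCounts classOf (not ∘ classOf) x d)     ≡⟨ sameCounts⇒sameValue v classOf classOf-equivalent _ c s refl sameCounts ⟩
    vᶠ v s                                            ≡⟨ cong v (tabulate∘lookup S) ⟩
    v S                                               ∎)
    where
    open ≡-Reasoning
    s = lookup S
    x = inside classOf s
    d = outside classOf s
    α = countᶠ classOf
    β = countᶠ (not ∘ classOf)
    c = withCounts classOf (not ∘ classOf) x d
    present : countᶠ (λ m → c m ∧ not (classOf m)) ≡ countᶠ (λ m → s m ∧ not (classOf m))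
    present = trans (countᶠ-pick-∧not classOf classOf (not ∘ classOf) (λ _ e → e) (λ _ e → e) x (β ∸ d) (m∸n≤m β d))
                    (trans (cong (_∸ d) (sym (present+outside classOf s))) (m+n∸n≡m _ d))
    sameCounts : SameCounts classOf c s
    sameCounts true  = trans (countᶠ-cong (λ m → cong (c m ∧_) (==-true (classOf m))))
                         (trans (proj₁ (cellCoalition classOf x d (inside≤ classOf s) (outside≤ classOf s)))
                                (countᶠ-cong (λ m → cong (s m ∧_) (sym (==-true (classOf m))))))
    sameCounts false = trans (countᶠ-cong (λ m → cong (c m ∧_) (==-false (classOf m))))
                         (trans present (countᶠ-cong (λ m → cong (s m ∧_) (sym (==-false (classOf m))))))

  gamePath-¬shiftInvariant : ¬ ShiftInvariant gamePath
  gamePath-¬shiftInvariant si = i≁j (Equivalent-cong (sym ∘ game≡pathGame) i j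
    (shiftInvariant⇒equivalent gamePath classOf i j si gamePath-fits classOf-i classOf-j))

  -- Swapping the classes if necessary makes the path canonical.
  twoClasses⇒canonicalPathGame : Σ Word λ w → Σ (Fin n → Bool) λ Q → Fits w Q × canonicalᵇ w ≡ true × (∀ S → v S ≡ pathGame w Q S)
  twoClasses⇒canonicalPathGame with gamePath ≤ˡᵉˣ dual gamePath in e
  ... | true  = gamePath , classOf , gamePath-fits , canonicalᵇ-intro gamePath gamePath-¬shiftInvariant e , game≡pathGame
  ... | false = dual gamePath , not ∘ classOf , Fits-dual gamePath classOf gamePath-fits ,
                canonicalᵇ-intro (dual gamePath) (gamePath-¬shiftInvariant ∘ shiftInvariant-dual⁻ gamePath)
                  (trans (cong (dual gamePath ≤ˡᵉˣ_) (dual-involutive gamePath)) (≤ˡᵉˣ-total gamePath (dual gamePath) e)) ,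
                λ S → trans (game≡pathGame S) (pathGame-dual gamePath classOf gamePath-fits S)

initialSegment : ∀ {n} → ℕ → Fin n → Bool
initialSegment a i = toℕ i <ᵇ a

countᶠ-initialSegment : ∀ {n} a → a ≤ n → countᶠ {n} (initialSegment a) ≡ a
countᶠ-initialSegment {zero}  zero    _       = refl
countᶠ-initialSegment {suc n} zero    _       = countᶠ-false {n}
countᶠ-initialSegment {suc n} (suc a) (s≤s p) = cong suc (countᶠ-initialSegment {n} a p)

-- The first class consists of the players 0 , … , rights w − 2.
representative : ∀ {n} → Word → Game n
representative w = pathGame w (initialSegment (pred (rights w)))

canonicalWords : ℕ → List Word
canonicalWords n = filterᵇ canonicalᵇ (words (n + 2))

Fits-representative : ∀ n w → length w ≡ n + 2 → canonicalᵇ w ≡ true → Fits {n} w (initialSegment (pred (rights w)))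
Fits-representative n w length-w c = fitsR , fitsD
  where
  ¬si : ¬ ShiftInvariant w
  ¬si = canonical⇒¬shiftInvariant w c
  a = pred (rights w)
  1+a : suc a ≡ rights w
  1+a = suc-pred (rights w) {{>-nonZero (≤-trans (s≤s z≤n) (¬shiftInvariant⇒2≤rights w ¬si))}}
  a+downs : a + downs w ≡ suc n
  a+downs = suc-injective (trans (cong (_+ downs w) 1+a) (trans (sym (length≡rights+downs w)) (trans length-w (+-comm n 2))))
  a≤n : a ≤ n
  a≤n = ≤-pred (≤-trans (subst (suc a ≤_) (sym (+-suc a 1)) (s≤s (m≤m+n a 1)))
                        (subst (a + 2 ≤_) a+downs (+-monoʳ-≤ a (¬shiftInvariant⇒2≤downs w ¬si))))
  #in #out : ℕ
  #in  = countᶠ {n} (initialSegment a)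
  #out = countᶠ {n} (not ∘ initialSegment a)
  #in≡a : #in ≡ a
  #in≡a = countᶠ-initialSegment a a≤n
  fitsR : rights w ≡ suc #in
  fitsR = trans (sym 1+a) (cong suc (sym #in≡a))
  fitsD : downs w ≡ suc #out
  fitsD = begin
    downs w               ≡⟨ sym (m+n∸m≡n a (downs w)) ⟩
    a + downs w ∸ a       ≡⟨ cong (_∸ a) a+downs ⟩
    suc n ∸ a             ≡⟨ +-∸-assoc 1 a≤n ⟩
    suc (n ∸ a)           ≡⟨ cong (λ z → suc (n ∸ z)) (sym #in≡a) ⟩
    suc (n ∸ #in)         ≡⟨ cong (λ z → suc (z ∸ #in)) (sym (countᶠ-complement (initialSegment a))) ⟩
    suc (#in + #out ∸ #in) ≡⟨ cong suc (m+n∸m≡n #in #out) ⟩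
    suc #out              ∎
    where open ≡-Reasoning

∈-canonicalWords⁻ : ∀ n {w} → w ∈ canonicalWords n → length w ≡ n + 2 × canonicalᵇ w ≡ true
∈-canonicalWords⁻ n w∈ with ∈-filterᵇ⁻ canonicalᵇ w∈
... | w∈words , c = ∈-words⁻ (n + 2) w∈words , c

representatives-twoClasses : ∀ n → All (λ v → IsSimpleGame v × HasExactlyTwoClasses v) (map (representative {n}) (canonicalWords n))
representatives-twoClasses n = All.map⁺ (All.tabulate λ {w} w∈ → twoClassGame w (∈-canonicalWords⁻ n w∈))
  where
  twoClassGame : ∀ w → length w ≡ n + 2 × canonicalᵇ w ≡ true → IsSimpleGame (representative {n} w) × HasExactlyTwoClasses (representative {n} w)
  twoClassGame w (length-w , c) =
    pathGame-isSimpleGame w _ (Fits-representative n w length-w c) (canonical⇒¬shiftInvariant w c) ,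
    pathGame-hasTwoClasses w _ (Fits-representative n w length-w c) (canonical⇒¬shiftInvariant w c)

AllPairs-map : ∀ {A B : Set} {P : A → Set} {R : A → A → Set} {S : B → B → Set} (f : A → B) →
               (∀ {x y} → P x → P y → R x y → S (f x) (f y)) → ∀ {xs} → All P xs → AllPairs R xs → AllPairs S (map f xs)
AllPairs-map f h []         []         = []
AllPairs-map {P = P} {R} {S} f h {x ∷ xs} (px ∷ pxs) (rxs ∷ rs) = related pxs rxs ∷ AllPairs-map f h pxs rs
  where
  related : ∀ {ys} → All P ys → All (R x) ys → All (S (f x)) (map f ys)
  related []         []         = []
  related (py ∷ pys) (r ∷ rs′) = h px py r ∷ related pys rs′

representatives-distinct : ∀ n → AllPairs (λ v w → ¬ Isomorphic v w) (map (representative {n}) (canonicalWords n))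
representatives-distinct n =
  AllPairs-map representative nonIsomorphic (All.tabulate (∈-canonicalWords⁻ n)) (Unique-filterᵇ canonicalᵇ (words-unique (n + 2)))
  where
  nonIsomorphic : ∀ {u u′} → length u ≡ n + 2 × canonicalᵇ u ≡ true → length u′ ≡ n + 2 × canonicalᵇ u′ ≡ true →
                  u ≢ u′ → ¬ Isomorphic (representative {n} u) (representative {n} u′)
  nonIsomorphic {u} {u′} (lu , cu) (lu′ , cu′) u≢u′ (σ , iso) =
    u≢u′ (rigidity u u′ Q (Q′ ∘ (σ ⟨$⟩ʳ_)) (Fits-representative n u lu cu) fits′ cu cu′
           (λ S → trans (sym (iso S)) (pathGame-image σ u′ (Q′ ∘ (σ ⟨$⟩ʳ_)) Q′ (λ _ → refl) S)))
    where
    Q Q′ : Fin n → Bool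
    Q  = initialSegment (pred (rights u))
    Q′ = initialSegment (pred (rights u′))
    fits′ : Fits u′ (Q′ ∘ (σ ⟨$⟩ʳ_))
    fits′ with Fits-representative n u′ lu′ cu′
    ... | fitsR , fitsD = trans fitsR (cong suc (sym (countᶠ-permute σ Q′))) ,
                          trans fitsD (cong suc (sym (countᶠ-permute σ (not ∘ Q′))))

representatives-complete : ∀ n (v : Game n) → IsSimpleGame v → HasExactlyTwoClasses v →
                           Any (Isomorphic v) (map (representative {n}) (canonicalWords n))
representatives-complete n v simple (i , j , i≁j , classes)
  with twoClasses⇒canonicalPathGame v simple i j i≁j classes
... | w , Q , (fitsR , fitsD) , c , v≡ with toFront Q
...   | σ , front = Any.map⁺ (Any.map (λ { refl → isomorphic }) w∈)
  where
  isomorphic : Isomorphic v (representative w)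
  isomorphic = σ , λ S → trans (pathGame-image σ w Q (initialSegment (pred (rights w)))
                                  (λ i → trans (cong (λ r → toℕ (σ ⟨$⟩ʳ i) <ᵇ pred r) fitsR) (front i)) S)
                               (sym (v≡ S))
  length-w : length w ≡ n + 2
  length-w = begin
    length w                                    ≡⟨ length≡rights+downs w ⟩
    rights w + downs w                          ≡⟨ cong₂ _+_ fitsR fitsD ⟩
    suc (countᶠ Q) + suc (countᶠ (not ∘ Q))     ≡⟨ +-suc (suc (countᶠ Q)) _ ⟩
    2 + (countᶠ Q + countᶠ (not ∘ Q))           ≡⟨ cong (2 +_) (countᶠ-complement Q) ⟩
    2 + n                                       ≡⟨ +-comm 2 n ⟩
    n + 2                                       ∎
    where open ≡-Reasoning
  w∈ : w ∈ canonicalWords n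
  w∈ = ∈-filterᵇ⁺ canonicalᵇ (∈-words⁺ (n + 2) length-w) c

-- Counting the representatives

#canonical : ℕ → ℕ
#canonical m = countᵇ canonicalᵇ (words m)

length-representatives : ∀ n → length (map (representative {n}) (canonicalWords n)) ≡ #canonical (n + 2)
length-representatives n = trans (length-map representative (canonicalWords n)) (length-filterᵇ canonicalᵇ (words (n + 2)))

#canonical-odd : ∀ j → #canonical (1 + j * 2 + 2) ≡ countOdd (1 + j * 2)
#canonical-odd j = trans (m+m+n*2≡o*2⇒m≡o∸n C H (2 ^ (n + 1)) burnside) (cong (2 ^ (n + 1) ∸_) (sym H≡))
  where
  n = 1 + j * 2
  m = n + 2
  C = #canonical m
  H = 2 * j * j + 5 * j + 4
  m≡ : m ≡ suc (suc j + suc j)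
  m≡ = ring j
    where
    ring : ∀ j → 1 + j * 2 + 2 ≡ suc (suc j + suc j)
    ring = solve-∀
  noSelfDual : countᵇ selfDualᵇ (words m) ≡ 0
  noSelfDual = trans (cong (countᵇ selfDualᵇ ∘ words) m≡) (countᵇ-selfDual-odd (suc j))
  noSquare : countᵇ (λ w → shiftInvariantᵇ w ∧ selfDualᵇ w) (words m) ≡ 0
  noSquare = m+n≡0⇒m≡0 _ (trans (sym (countᵇ-split shiftInvariantᵇ selfDualᵇ (words m))) noSelfDual)
  D≡ : countᵇ shiftInvariantᵇ (words m) ≡ H * 2
  D≡ = trans (countᵇ-shiftInvariant m (s≤s z≤n)) (ring j)
    where
    ring : ∀ j → 2 + (j * 2 + 2) * (1 + j * 2 + 2) ≡ (2 * j * j + 5 * j + 4) * 2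
    ring = solve-∀
  H≡ : (n * n + 3 * n + 4) / 2 ≡ H
  H≡ = trans (cong (_/ 2) (ring j)) (m*n/n≡m H 2)
    where
    ring : ∀ j → (1 + j * 2) * (1 + j * 2) + 3 * (1 + j * 2) + 4 ≡ (2 * j * j + 5 * j + 4) * 2
    ring = solve-∀
  burnside : C + C + H * 2 ≡ 2 ^ (n + 1) * 2
  burnside = begin
    C + C + H * 2                                     ≡⟨ cong (C + C +_) (sym D≡) ⟩
    C + C + countᵇ shiftInvariantᵇ (words m)          ≡⟨ sym (+-identityʳ _) ⟩
    C + C + countᵇ shiftInvariantᵇ (words m) + 0      ≡⟨ cong (C + C + countᵇ shiftInvariantᵇ (words m) +_) (sym noSquare) ⟩
    C + C + countᵇ shiftInvariantᵇ (words m) + countᵇ (λ w → shiftInvariantᵇ w ∧ selfDualᵇ w) (words m) ≡⟨ countᵇ-canonical m ⟩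
    2 ^ m + countᵇ selfDualᵇ (words m)                ≡⟨ cong₂ _+_ (2^[n+2] n) noSelfDual ⟩
    2 ^ (n + 1) * 2 + 0                               ≡⟨ +-identityʳ _ ⟩
    2 ^ (n + 1) * 2                                   ∎
    where open ≡-Reasoning

#canonical-even : ∀ j → #canonical (j * 2 + 2) ≡ countEven (j * 2)
#canonical-even j = begin
  #canonical (j * 2 + 2)             ≡⟨ cong #canonical m≡ ⟩
  C                                  ≡⟨ m+m+n*2≡o*2⇒m≡o∸n C H (2 ^ (n + 1) + 2 ^ j) burnside ⟩
  2 ^ (n + 1) + 2 ^ j ∸ H            ≡⟨ cong₂ (λ h x → 2 ^ (n + 1) + 2 ^ h ∸ x) (sym (m*n/n≡m j 2)) (sym H≡) ⟩
  countEven n                        ∎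
  where
  open ≡-Reasoning
  n = j * 2
  k = suc j
  m = k + k
  C = #canonical m
  H = 2 * j * j + 4 * j + 3
  m≡ : n + 2 ≡ m
  m≡ = ring j
    where
    ring : ∀ j → j * 2 + 2 ≡ suc j + suc j
    ring = solve-∀
  D+DF≡ : countᵇ shiftInvariantᵇ (words m) + countᵇ (λ w → shiftInvariantᵇ w ∧ selfDualᵇ w) (words m) ≡ H * 2
  D+DF≡ = trans (cong₂ _+_ (countᵇ-shiftInvariant m (s≤s z≤n)) (countᵇ-shiftInvariant∧selfDual k (s≤s z≤n))) (ring j)
    where
    ring : ∀ j → 2 + (j + suc j) * (suc j + suc j) + (suc j + suc j) ≡ (2 * j * j + 4 * j + 3) * 2
    ring = solve-∀
  H≡ : (n * n + 4 * n + 6) / 2 ≡ H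
  H≡ = trans (cong (_/ 2) (ring j)) (m*n/n≡m H 2)
    where
    ring : ∀ j → (j * 2) * (j * 2) + 4 * (j * 2) + 6 ≡ (2 * j * j + 4 * j + 3) * 2
    ring = solve-∀
  burnside : C + C + H * 2 ≡ (2 ^ (n + 1) + 2 ^ j) * 2
  burnside = begin
    C + C + H * 2                                    ≡⟨ cong (C + C +_) (sym D+DF≡) ⟩
    C + C + (countᵇ shiftInvariantᵇ (words m) + countᵇ (λ w → shiftInvariantᵇ w ∧ selfDualᵇ w) (words m)) ≡⟨ sym (+-assoc (C + C) _ _) ⟩
    C + C + countᵇ shiftInvariantᵇ (words m) + countᵇ (λ w → shiftInvariantᵇ w ∧ selfDualᵇ w) (words m) ≡⟨ countᵇ-canonical m ⟩
    2 ^ m + countᵇ selfDualᵇ (words m)               ≡⟨ cong₂ _+_ (trans (cong (2 ^_) (sym m≡)) (2^[n+2] n))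
                                                                  (trans (countᵇ-selfDual-even k) (*-comm 2 (2 ^ j))) ⟩
    2 ^ (n + 1) * 2 + 2 ^ j * 2                      ≡⟨ sym (*-distribʳ-+ 2 (2 ^ (n + 1)) (2 ^ j)) ⟩
    (2 ^ (n + 1) + 2 ^ j) * 2                        ∎

#canonical-oddLength : ∀ n → n % 2 ≡ 1 → #canonical (n + 2) ≡ countOdd n
#canonical-oddLength n odd = subst (λ n → #canonical (n + 2) ≡ countOdd n) (sym n≡) (#canonical-odd (n / 2))
  where
  n≡ : n ≡ 1 + n / 2 * 2
  n≡ = trans (m≡m%n+[m/n]*n n 2) (cong (_+ n / 2 * 2) odd)

#canonical-evenLength : ∀ n → n % 2 ≡ 0 → #canonical (n + 2) ≡ countEven n
#canonical-evenLength n even = subst (λ n → #canonical (n + 2) ≡ countEven n) (sym n≡) (#canonical-even (n / 2))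
  where
  n≡ : n ≡ n / 2 * 2
  n≡ = trans (m≡m%n+[m/n]*n n 2) (cong (_+ n / 2 * 2) even)

mainTheorem1 : ∀ (n : ℕ) → 2 ≤ n →
    Σ (List (Game n)) λ L →
    All (λ v → IsSimpleGame v × HasExactlyTwoClasses v) L
    × AllPairs (λ v w → ¬ Isomorphic v w) L
    × (∀ (v : Game n) → IsSimpleGame v → HasExactlyTwoClasses v → Any (Isomorphic v) L)
    × (n % 2 ≡ 1 → length L ≡ countOdd n)
    × (n % 2 ≡ 0 → length L ≡ countEven n)
mainTheorem1 n _ =
  map representative (canonicalWords n) ,
  representatives-twoClasses n ,
  representatives-distinct n ,
  representatives-complete n ,
  (λ odd → trans (length-representatives n) (#canonical-oddLength n odd)) ,
  (λ even → trans (length-representatives n) (#canonical-evenLength n even))
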